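{- For every permutation $X$ of $[n]$, $\mathsf{OPT}_{\mathtt{bst}}(X)=\mathsf{OPT}_{\mathtt{bst}}(X')=\mathsf{OPT}_{\mathtt{bst}}(X^r)$.
   Context: For a permutation $X=(x_1,\dots,x_n)$: $X'=(y_1,\dots,y_n)$ with $y_i=j$ iff $x_j=i$ (inverse), and $X^r=(x_n,\dots,x_1)$ (reverse). Offline BST algorithm in search-only mode: starting from an initial binary search tree on $[n]$ (chosen by the algorithm), keys $x_1,\dots,x_n$ are searched in order, the whole sequence known in advance. Each operation starts with a cursor at the root; unit-cost steps move the cursor to the parent, left child or right child, or rotate the edge between the cursor node and its parent; during the $j$-th operation the cursor must visit $x_j$, and arbitrary rotations at the cursor are allowed. The cost is the total number of pairs (node, operation) such that the node is visited by the cursor during that operation. $\mathsf{OPT}_{\mathtt{bst}}(X)$ is the minimum cost over all such algorithms and initial trees. -}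

module Defs where

open import Data.Nat using (ℕ; zero; suc; _+_; _≤_)
open import Data.Fin using (Fin; _≟_)
open import Data.Fin.Permutation using (Permutation′; _⟨$⟩ʳ_)
open import Data.List using (List; []; _∷_; _++_; map; allFin)
open import Data.Bool.ListAction using (any)
open import Data.Maybe using (Maybe; just; nothing)
open import Data.Bool using (Bool; true; false)
open import Data.Product using (Σ; _×_; _,_)
open import Relation.Nullary.Decidable using (⌊_⌋)
open import Relation.Binary.PropositionalEquality using (_≡_)

data Tree (n : ℕ) : Set where
  leaf : Tree n
  node : Tree n → Fin n → Tree n → Tree n

inorder : ∀ {n} → Tree n → List (Fin n)
inorder leaf = []
inorder (node l k r) = inorder l ++ (k ∷ inorder r)

IsBSTOn : ∀ {n} → Tree n → Set
IsBSTOn {n} t = inorder t ≡ allFin n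

-- Zipper: cursor position inside a tree.
-- wentL p r : the cursor is in the left subtree of node p whose right subtree is r
-- wentR l p : the cursor is in the right subtree of node p whose left subtree is l
data Frame (n : ℕ) : Set where
  wentL : Fin n → Tree n → Frame n
  wentR : Tree n → Fin n → Frame n

record Zipper (n : ℕ) : Set where
  constructor zip
  field
    focus : Tree n
    ctx   : List (Frame n)   -- path back to the root (innermost frame first)

atRoot : ∀ {n} → Tree n → Zipper n
atRoot t = zip t []

plugFrame : ∀ {n} → Frame n → Tree n → Tree n
plugFrame (wentL p r) t = node t p r
plugFrame (wentR l p) t = node l p t

plugCtx : ∀ {n} → List (Frame n) → Tree n → Tree n
plugCtx [] t = t
plugCtx (f ∷ fs) t = plugCtx fs (plugFrame f t)

plug : ∀ {n} → Zipper n → Tree n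
plug (zip t fs) = plugCtx fs t

data Move : Set where
  toParent toLeft toRight rotate : Move

-- One step; nothing if the step is not possible.
-- rotate: rotate the edge between the cursor node and its parent
-- (the cursor stays on the same node, which moves up one level).
step : ∀ {n} → Move → Zipper n → Maybe (Zipper n)
step toParent (zip t []) = nothing
step toParent (zip t (f ∷ fs)) = just (zip (plugFrame f t) fs)
step toLeft (zip (node (node a x b) k r) fs) = just (zip (node a x b) (wentL k r ∷ fs))
step toLeft _ = nothing
step toRight (zip (node l k (node a x b)) fs) = just (zip (node a x b) (wentR l k ∷ fs))
step toRight _ = nothing
step rotate (zip (node a x b) (wentL p c ∷ fs)) = just (zip (node a x (node b p c)) fs)
step rotate (zip (node b x c) (wentR a p ∷ fs)) = just (zip (node (node a p b) x c) fs)
step rotate _ = nothing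

-- key of the node under the cursor (as a list: empty iff the tree is empty)
cursorKey : ∀ {n} → Zipper n → List (Fin n)
cursorKey (zip leaf _) = []
cursorKey (zip (node _ k _) _) = k ∷ []

runSteps : ∀ {n} → Zipper n → List Move → Maybe (Zipper n × List (Fin n))
runSteps z [] = just (z , [])
runSteps z (m ∷ ms) with step m z
... | nothing = nothing
... | just z′ with runSteps z′ ms
...   | nothing = nothing
...   | just (z″ , vs) = just (z″ , cursorKey z′ ++ vs)

_∈ᵇ_ : ∀ {n} → Fin n → List (Fin n) → Bool
k ∈ᵇ vs = any (λ v → ⌊ k ≟ v ⌋) vs

countTrue : ∀ {n} → List (Fin n) → List (Fin n) → ℕ
countTrue [] vs = 0
countTrue (k ∷ ks) vs with k ∈ᵇ vs
... | true = suc (countTrue ks vs)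
... | false = countTrue ks vs

distinctCount : ∀ {n} → List (Fin n) → ℕ
distinctCount {n} vs = countTrue (allFin n) vs

-- Each operation starts with the cursor at the root; the cost of an operation
-- is the number of distinct nodes visited by the cursor (including the root);
-- the operation is valid only if the searched key is visited.
serveCost : ∀ {n} → Tree n → List (Fin n) → List (List Move) → Maybe ℕ
serveCost t [] [] = just 0
serveCost t [] (_ ∷ _) = nothing
serveCost t (_ ∷ _) [] = nothing
serveCost t (x ∷ xs) (ms ∷ mss) with runSteps (atRoot t) ms
... | nothing = nothing
... | just (z , vs) with x ∈ᵇ (cursorKey (atRoot t) ++ vs)
...   | false = nothing
...   | true with serveCost (plug z) xs mss
...     | nothing = nothing
...     | just c = just (distinctCount (cursorKey (atRoot t) ++ vs) + c)

Achievable : ∀ {n} → List (Fin n) → ℕ → Set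
Achievable {n} xs c =
  Σ (Tree n) λ t → Σ (List (List Move)) λ mss → IsBSTOn t × serveCost t xs mss ≡ just c

IsOPT : ∀ {n} → List (Fin n) → ℕ → Set
IsOPT xs c = Achievable xs c × (∀ c′ → Achievable xs c′ → c ≤ c′)

seqOf : ∀ {n} → Permutation′ n → List (Fin n)
seqOf {n} X = map (X ⟨$⟩ʳ_) (allFin n)

module Submission where

-- We follow the geometric view of binary search trees (Demaine, Harmon,
-- Iacono, Kane, Pătraşcu).  For a search sequence f : [m] → [n] consider
-- Boolean matrices Q : [m] × [n] (time × key) containing every access point
-- (t , f t).  Q is *arborally satisfied* if any two points of Q in different
-- rows and columns span a rectangle holding a third point of Q.
--
--  * forward: the (time , visited node) pairs of any valid execution form a
--    satisfied superset whose size is the cost.  The key invariant is that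
--    an operation only rearranges the part of the tree it visits, so the
--    subtrees hanging off the visited part ("cut" of the tree) are unchanged.
--  * backward: every satisfied superset can be served with cost at most its
--    size, by keeping the tree heap-ordered by next touch time and, at each
--    step, rebuilding the touched top part greedily.
--
-- Hence OPT(f) is the least size of a satisfied superset (found by finite
-- search).  Satisfaction and size are invariant under swapping the axes
-- (inverse permutation) and reflecting time (reversed sequence), so all three
-- optima of the theorem coincide; the theorem is proved at the very end.

open import Defs
open import Data.Nat as ℕ using (ℕ; zero; suc; z≤n; s≤s; _+_; _∸_)
import Data.Nat.Properties as ℕP
open import Data.Fin as F using (Fin; toℕ; fromℕ<; opposite; inject₁; fromℕ; _≟_)
import Data.Fin.Properties as FP
open import Data.Fin.Permutation using (Permutation′; flip; _⟨$⟩ʳ_; _⟨$⟩ˡ_; inverseˡ; inverseʳ)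
import Data.Fin.Permutation as Perm
open import Data.List using (List; []; _∷_; _++_; _∷ʳ_; map; allFin; tabulate; reverse; length; concatMap)
open import Data.List.Properties
  using (++-assoc; ++-identityʳ; concatMap-++; length-++; length-tabulate; map-tabulate; tabulate-cong; unfold-reverse)
open import Data.List.Membership.Propositional using (_∈_)
open import Data.List.Membership.Propositional.Properties using (∈-++⁺ˡ; ∈-++⁺ʳ; ∈-++⁻; ∈-allFin)
import Data.List.Relation.Unary.Any as Any
open import Data.List.Relation.Unary.All as All using (All; []; _∷_)
import Data.List.Relation.Unary.All.Properties as AllP
open import Data.List.Relation.Unary.AllPairs using (AllPairs; []; _∷_)
import Data.List.Relation.Unary.AllPairs.Properties as APP
open import Data.Bool using (Bool; true; false; if_then_else_; _∨_)
open import Data.Bool.Properties as BP using (∨-assoc; ∨-identityʳ; ∨-zeroʳ)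
import Data.Vec.Functional as Vector
open import Data.Nat.Induction using (<-rec; <-wellFounded)
open import Induction.WellFounded using (Acc; acc)
open import Data.Maybe using (just; nothing)
open import Data.Product using (Σ; ∃; _×_; _,_; proj₁; proj₂)
open import Data.Sum using (_⊎_; inj₁; inj₂)
open import Data.Empty using (⊥; ⊥-elim)
open import Function using (_∘_; id)
open import Relation.Nullary using (¬_; yes; no; Dec)
open import Relation.Nullary.Decidable using (⌊_⌋; _×-dec_; _⊎-dec_; _→-dec_; ¬?)
open import Relation.Binary using (tri<; tri≈; tri>)
open import Relation.Binary.PropositionalEquality
open import Algebra.Properties.CommutativeMonoid.Sum ℕP.+-0-commutativeMonoid
  using (sum; ∑-comm; sum-cong-≗; ∑-permute)

bool-clash : ∀ {b} → b ≡ false → b ≡ true → ⊥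
bool-clash refl ()

≟-refl : ∀ {n} (x : Fin n) → ⌊ x ≟ x ⌋ ≡ true
≟-refl x with x ≟ x
... | yes _ = refl
... | no x≢x = ⊥-elim (x≢x refl)

≟-true : ∀ {n} {x y : Fin n} → ⌊ y ≟ x ⌋ ≡ true → y ≡ x
≟-true {x = x} {y} e with y ≟ x
... | yes y≡x = y≡x

Between : ∀ {n} → Fin n → Fin n → Fin n → Set
Between a b c = (a F.≤ c × c F.≤ b) ⊎ (b F.≤ c × c F.≤ a)

between-left : ∀ {n} (a b : Fin n) → Between a b a
between-left a b with ℕP.≤-total (toℕ a) (toℕ b)
... | inj₁ a≤b = inj₁ (ℕP.≤-refl , a≤b)
... | inj₂ b≤a = inj₂ (b≤a , ℕP.≤-refl)

between-sym : ∀ {n} {a b c : Fin n} → Between a b c → Between b a c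
between-sym (inj₁ p) = inj₂ p
between-sym (inj₂ p) = inj₁ p

between-trans : ∀ {n} {s y k z : Fin n} → Between s y k → Between s k z → Between s y z
between-trans (inj₁ (sk , ky)) (inj₁ (sz , zk)) = inj₁ (sz , ℕP.≤-trans zk ky)
between-trans (inj₁ (sk , ky)) (inj₂ (kz , zs)) = inj₁ (ℕP.≤-trans sk kz , ℕP.≤-trans zs (ℕP.≤-trans sk ky))
between-trans (inj₂ (yk , ks)) (inj₁ (sz , zk)) = inj₂ (ℕP.≤-trans yk (ℕP.≤-trans ks sz) , ℕP.≤-trans zk ks)
between-trans (inj₂ (yk , ks)) (inj₂ (kz , zs)) = inj₂ (ℕP.≤-trans yk kz , zs)

between? : ∀ {n} (a b c : Fin n) → Dec (Between a b c)
between? a b c = ((a FP.≤? c) ×-dec (c FP.≤? b)) ⊎-dec ((b FP.≤? c) ×-dec (c FP.≤? a))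

opposite-mono : ∀ {m} {i j : Fin m} → i F.≤ j → opposite j F.≤ opposite i
opposite-mono {suc m} {i} {j} i≤j rewrite FP.opposite-prop i | FP.opposite-prop j = ℕP.∸-monoʳ-≤ m i≤j

opposite-swap : ∀ {m} {i j : Fin m} → i F.≤ opposite j → j F.≤ opposite i
opposite-swap {j = j} p = subst (F._≤ _) (FP.opposite-involutive j) (opposite-mono p)

opposite-swap′ : ∀ {m} {i j : Fin m} → opposite i F.≤ j → opposite j F.≤ i
opposite-swap′ {i = i} p = subst (_ F.≤_) (FP.opposite-involutive i) (opposite-mono p)

between-opposite : ∀ {m} {a b c : Fin m} → Between (opposite a) (opposite b) c → Between a b (opposite c)
between-opposite (inj₁ (ac , cb)) = inj₂ (opposite-swap cb , opposite-swap′ ac)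
between-opposite (inj₂ (bc , ca)) = inj₁ (opposite-swap ca , opposite-swap′ bc)

dist : ∀ {n} → Fin n → Fin n → ℕ
dist s y = (toℕ y ∸ toℕ s) + (toℕ s ∸ toℕ y)

dist-between : ∀ {n} {s y k : Fin n} → Between s y k → k ≢ y → dist s k ℕ.< dist s y
dist-between {s = s} {y} {k} (inj₁ (sk , ky)) k≢y
  rewrite ℕP.m≤n⇒m∸n≡0 sk | ℕP.m≤n⇒m∸n≡0 (ℕP.≤-trans sk ky)
        | ℕP.+-identityʳ (toℕ k ∸ toℕ s) | ℕP.+-identityʳ (toℕ y ∸ toℕ s)
  = ℕP.∸-monoˡ-< (ℕP.≤∧≢⇒< ky (k≢y ∘ FP.toℕ-injective)) sk
dist-between {s = s} {y} {k} (inj₂ (yk , ks)) k≢y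
  rewrite ℕP.m≤n⇒m∸n≡0 ks | ℕP.m≤n⇒m∸n≡0 (ℕP.≤-trans yk ks)
  = ℕP.∸-monoʳ-< (ℕP.≤∧≢⇒< yk (k≢y ∘ sym ∘ FP.toℕ-injective)) ks

data _∈ₜ_ {n} (x : Fin n) : Tree n → Set where
  here : ∀ {l r} → x ∈ₜ node l x r
  inl : ∀ {l k r} → x ∈ₜ l → x ∈ₜ node l k r
  inr : ∀ {l k r} → x ∈ₜ r → x ∈ₜ node l k r

∈ₜ⇒∈inorder : ∀ {n} {x : Fin n} {t} → x ∈ₜ t → x ∈ inorder t
∈ₜ⇒∈inorder {t = node l k r} here = ∈-++⁺ʳ (inorder l) (Any.here refl)
∈ₜ⇒∈inorder {t = node l k r} (inl p) = ∈-++⁺ˡ (∈ₜ⇒∈inorder p)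
∈ₜ⇒∈inorder {t = node l k r} (inr p) = ∈-++⁺ʳ (inorder l) (Any.there (∈ₜ⇒∈inorder p))

∈inorder⇒∈ₜ : ∀ {n} {x : Fin n} t → x ∈ inorder t → x ∈ₜ t
∈inorder⇒∈ₜ (node l k r) p with ∈-++⁻ (inorder l) p
... | inj₁ q = inl (∈inorder⇒∈ₜ l q)
... | inj₂ (Any.here refl) = here
... | inj₂ (Any.there q) = inr (∈inorder⇒∈ₜ r q)

∈ₜ-inorder : ∀ {n} {t t′ : Tree n} → inorder t ≡ inorder t′ → ∀ {x} → x ∈ₜ t → x ∈ₜ t′
∈ₜ-inorder {t′ = t′} e p = ∈inorder⇒∈ₜ t′ (subst (_ ∈_) e (∈ₜ⇒∈inorder p))

data SearchTree {n} : Tree n → Set where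
  leafS : SearchTree leaf
  nodeS : ∀ {l k r} → SearchTree l → SearchTree r →
          (∀ {x} → x ∈ₜ l → x F.< k) → (∀ {x} → x ∈ₜ r → k F.< x) → SearchTree (node l k r)

private
  Sorted : ∀ {n} → List (Fin n) → Set
  Sorted = AllPairs F._<_

  sorted-++ : ∀ {n} (xs ys : List (Fin n)) → Sorted (xs ++ ys) →
    Sorted xs × Sorted ys × (∀ {x y} → x ∈ xs → y ∈ ys → x F.< y)
  sorted-++ [] ys s = [] , s , λ ()
  sorted-++ (x ∷ xs) ys (x< ∷ s) with sorted-++ xs ys s
  ... | sxs , sys , xs<ys =
    AllP.++⁻ˡ xs x< ∷ sxs , sys ,
    λ { (Any.here refl) q → All.lookup (AllP.++⁻ʳ xs x<) q ; (Any.there p) q → xs<ys p q }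

  sorted⇒SearchTree : ∀ {n} (t : Tree n) → Sorted (inorder t) → SearchTree t
  sorted⇒SearchTree leaf s = leafS
  sorted⇒SearchTree (node l k r) s with sorted-++ (inorder l) (k ∷ inorder r) s
  ... | sl , (k< ∷ sr) , l<kr =
    nodeS (sorted⇒SearchTree l sl) (sorted⇒SearchTree r sr)
          (λ p → l<kr (∈ₜ⇒∈inorder p) (Any.here refl)) (λ p → All.lookup k< (∈ₜ⇒∈inorder p))

bstOn⇒SearchTree : ∀ {n} (t : Tree n) → IsBSTOn t → SearchTree t
bstOn⇒SearchTree {n} t e = sorted⇒SearchTree t (subst Sorted (sym e) (APP.tabulate⁺-< (λ p → p)))

bstOn-∈ : ∀ {n} (t : Tree n) → IsBSTOn t → ∀ x → x ∈ₜ t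
bstOn-∈ t e x = ∈inorder⇒∈ₜ t (subst (x ∈_) (sym e) (∈-allFin x))

-- Anc t a b : a is an ancestor of b (or b itself) in t.
data Anc {n} : Tree n → Fin n → Fin n → Set where
  root : ∀ {l a r b} → b ∈ₜ node l a r → Anc (node l a r) a b
  viaL : ∀ {l k r a b} → Anc l a b → Anc (node l k r) a b
  viaR : ∀ {l k r a b} → Anc r a b → Anc (node l k r) a b

anc-∈ : ∀ {n} {t : Tree n} {a b} → Anc t a b → b ∈ₜ t
anc-∈ (root p) = p
anc-∈ (viaL p) = inl (anc-∈ p)
anc-∈ (viaR p) = inr (anc-∈ p)

anc-self : ∀ {n} {t : Tree n} {r} → r ∈ₜ t → Anc t r r
anc-self here = root here
anc-self (inl p) = viaL (anc-self p)
anc-self (inr p) = viaR (anc-self p)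

lca< : ∀ {n} {t : Tree n} → SearchTree t → ∀ {a b} → a ∈ₜ t → b ∈ₜ t → a F.< b →
  ∃ λ c → a F.≤ c × c F.≤ b × Anc t c a × Anc t c b
lca< (nodeS _ _ _ _) here pb a<b = _ , ℕP.≤-refl , ℕP.<⇒≤ a<b , root here , root pb
lca< (nodeS _ _ _ _) (inl pa) here a<b = _ , ℕP.<⇒≤ a<b , ℕP.≤-refl , root (inl pa) , root here
lca< (nodeS _ _ _ k<r) (inr pa) here a<b = ⊥-elim (ℕP.<-asym a<b (k<r pa))
lca< (nodeS sl _ _ _) (inl pa) (inl pb) a<b with lca< sl pa pb a<b
... | c , ac , cb , ca , cb′ = c , ac , cb , viaL ca , viaL cb′
lca< (nodeS _ _ l<k k<r) (inl pa) (inr pb) a<b =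
  _ , ℕP.<⇒≤ (l<k pa) , ℕP.<⇒≤ (k<r pb) , root (inl pa) , root (inr pb)
lca< (nodeS _ _ l<k k<r) (inr pa) (inl pb) a<b = ⊥-elim (ℕP.<-asym a<b (ℕP.<-trans (l<k pb) (k<r pa)))
lca< (nodeS _ sr _ _) (inr pa) (inr pb) a<b with lca< sr pa pb a<b
... | c , ac , cb , ca , cb′ = c , ac , cb , viaR ca , viaR cb′

lca : ∀ {n} {t : Tree n} → SearchTree t → ∀ {a b} → a ∈ₜ t → b ∈ₜ t → a ≢ b →
  ∃ λ c → Between a b c × Anc t c a × Anc t c b
lca st {a} {b} pa pb a≢b with FP.<-cmp a b
... | tri< a<b _ _ = let (c , ac , cb , ca , cb′) = lca< st pa pb a<b in c , inj₁ (ac , cb) , ca , cb′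
... | tri≈ _ a≡b _ = ⊥-elim (a≢b a≡b)
... | tri> _ _ b<a = let (c , bc , ca , cb , ca′) = lca< st pb pa b<a in c , inj₂ (bc , ca) , ca′ , cb

data Sub {n} (τ : Tree n) : Tree n → Set where
  self : Sub τ τ
  underL : ∀ {l k r} → Sub τ l → Sub τ (node l k r)
  underR : ∀ {l k r} → Sub τ r → Sub τ (node l k r)

sub-∈ : ∀ {n} {τ t : Tree n} {x} → Sub τ t → x ∈ₜ τ → x ∈ₜ t
sub-∈ self p = p
sub-∈ (underL s) p = inl (sub-∈ s p)
sub-∈ (underR s) p = inr (sub-∈ s p)

sub-anc : ∀ {n} {l r t : Tree n} {k x} → Sub (node l k r) t → x ∈ₜ node l k r → Anc t k x
sub-anc self p = root p
sub-anc (underL s) p = viaL (sub-anc s p)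
sub-anc (underR s) p = viaR (sub-anc s p)

sub-left : ∀ {n} {l r T : Tree n} {k} → Sub (node l k r) T → Sub l T
sub-left self = underL self
sub-left (underL s) = underL (sub-left s)
sub-left (underR s) = underR (sub-left s)

sub-right : ∀ {n} {l r T : Tree n} {k} → Sub (node l k r) T → Sub r T
sub-right self = underR self
sub-right (underL s) = underL (sub-right s)
sub-right (underR s) = underR (sub-right s)

sub-search : ∀ {n} {τ t : Tree n} → Sub τ t → SearchTree t → SearchTree τ
sub-search self st = st
sub-search (underL s) (nodeS sl _ _ _) = sub-search s sl
sub-search (underR s) (nodeS _ sr _ _) = sub-search s sr

interval-left : ∀ {n} {T l r : Tree n} {k y z} → SearchTree T → Sub (node l k r) T → y ∈ₜ l →
  z ∈ₜ T → y F.≤ z → z F.< k → z ∈ₜ l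
interval-left (nodeS _ _ _ _) self py here yz zk = ⊥-elim (ℕP.<-irrefl refl zk)
interval-left (nodeS _ _ _ _) self py (inl pz) yz zk = pz
interval-left (nodeS _ _ _ k<r) self py (inr pz) yz zk = ⊥-elim (ℕP.<-asym zk (k<r pz))
interval-left (nodeS _ _ l<k _) (underL s) py here yz zk = ⊥-elim (ℕP.<-asym zk (l<k (sub-∈ s here)))
interval-left (nodeS sl _ _ _) (underL s) py (inl pz) yz zk = interval-left sl s py pz yz zk
interval-left (nodeS _ _ l<k k<r) (underL s) py (inr pz) yz zk =
  ⊥-elim (ℕP.<-asym (ℕP.<-trans zk (l<k (sub-∈ s here))) (k<r pz))
interval-left (nodeS _ _ _ k<r) (underR s) py here yz zk =
  ⊥-elim (ℕP.<-irrefl refl (ℕP.<-≤-trans (k<r (sub-∈ s (inl py))) yz))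
interval-left (nodeS _ _ l<k k<r) (underR s) py (inl pz) yz zk =
  ⊥-elim (ℕP.<-irrefl refl (ℕP.<-≤-trans (ℕP.<-trans (l<k pz) (k<r (sub-∈ s (inl py)))) yz))
interval-left (nodeS _ sr _ _) (underR s) py (inr pz) yz zk = interval-left sr s py pz yz zk

interval-right : ∀ {n} {T l r : Tree n} {k y z} → SearchTree T → Sub (node l k r) T → y ∈ₜ r →
  z ∈ₜ T → z F.≤ y → k F.< z → z ∈ₜ r
interval-right (nodeS _ _ _ _) self py here zy kz = ⊥-elim (ℕP.<-irrefl refl kz)
interval-right (nodeS _ _ l<k _) self py (inl pz) zy kz = ⊥-elim (ℕP.<-asym kz (l<k pz))
interval-right (nodeS _ _ _ _) self py (inr pz) zy kz = pz
interval-right (nodeS _ _ _ k<r) (underR s) py here zy kz = ⊥-elim (ℕP.<-asym kz (k<r (sub-∈ s here)))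
interval-right (nodeS _ sr _ _) (underR s) py (inr pz) zy kz = interval-right sr s py pz zy kz
interval-right (nodeS _ _ l<k k<r) (underR s) py (inl pz) zy kz =
  ⊥-elim (ℕP.<-asym (ℕP.<-trans (k<r (sub-∈ s here)) kz) (l<k pz))
interval-right (nodeS _ _ l<k _) (underL s) py here zy kz =
  ⊥-elim (ℕP.<-irrefl refl (ℕP.≤-<-trans zy (l<k (sub-∈ s (inr py)))))
interval-right (nodeS _ _ l<k k<r) (underL s) py (inr pz) zy kz =
  ⊥-elim (ℕP.<-irrefl refl (ℕP.≤-<-trans zy (ℕP.<-trans (l<k (sub-∈ s (inr py))) (k<r pz))))
interval-right (nodeS sl _ _ _) (underL s) py (inl pz) zy kz = interval-right sl s py pz zy kz

-- Cutting a tree below a set of keys.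
--
-- For V : Fin n → Bool, cut V t lists the maximal subtrees of t hanging
-- below the V-nodes reachable from the root through V-nodes.  An operation
-- that visits exactly V only rearranges the top part, so it leaves cut V
-- unchanged; this is the invariant behind the forward direction.

cut : ∀ {n} → (Fin n → Bool) → Tree n → List (Tree n)
cut V leaf = leaf ∷ []
cut V (node l k r) = if V k then cut V l ++ cut V r else node l k r ∷ []

cut-inside : ∀ {n} (V : Fin n → Bool) {l k r} → V k ≡ true → cut V (node l k r) ≡ cut V l ++ cut V r
cut-inside V Vk rewrite Vk = refl

Untouched : ∀ {n} → (Fin n → Bool) → Tree n → Set
Untouched V h = ∀ {y} → y ∈ₜ h → V y ≡ false

-- V is exactly a top part of t: every hanging subtree avoids V.
Closed : ∀ {n} → (Fin n → Bool) → Tree n → Set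
Closed V t = All (Untouched V) (cut V t)

cut-sub : ∀ {n} V (t : Tree n) {h} → h ∈ cut V t → Sub h t
cut-sub V leaf (Any.here refl) = self
cut-sub V (node l k r) m with V k
cut-sub V (node l k r) m | true with ∈-++⁻ (cut V l) m
... | inj₁ m′ = underL (cut-sub V l m′)
... | inj₂ m′ = underR (cut-sub V r m′)
cut-sub V (node l k r) (Any.here refl) | false = self

cut-anc : ∀ {n} V {t : Tree n} {a b} → Anc t a b → V a ≡ false → ∃ λ h → h ∈ cut V t × Anc h a b
cut-anc V (root p) Va rewrite Va = _ , Any.here refl , root p
cut-anc V {node l k r} (viaL p) Va with V k
... | true = let (h , m , q) = cut-anc V p Va in h , ∈-++⁺ˡ m , q
... | false = _ , Any.here refl , viaL p
cut-anc V {node l k r} (viaR p) Va with V k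
... | true = let (h , m , q) = cut-anc V p Va in h , ∈-++⁺ʳ (cut V l) m , q
... | false = _ , Any.here refl , viaR p

anc-cut : ∀ {n} V (t : Tree n) {h a b} → h ∈ cut V t → Anc h a b → Anc t a b
anc-cut V t m p = go (cut-sub V t m) p
  where
  go : ∀ {h t a b} → Sub h t → Anc h a b → Anc t a b
  go self p = p
  go (underL s) p = viaL (go s p)
  go (underR s) p = viaR (go s p)

cut-hang : ∀ {n} V (t : Tree n) {h y} → h ∈ cut V t → y ∈ₜ h → ∃ λ a → V a ≡ false × Anc t a y
cut-hang V leaf (Any.here refl) ()
cut-hang V (node l k r) m p with V k in Vk
cut-hang V (node l k r) m p | true with ∈-++⁻ (cut V l) m
... | inj₁ m′ = let (a , Va , an) = cut-hang V l m′ p in a , Va , viaL an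
... | inj₂ m′ = let (a , Va , an) = cut-hang V r m′ p in a , Va , viaR an
cut-hang V (node l k r) (Any.here refl) p | false = k , Vk , root p

closed-anc : ∀ {n} V {t : Tree n} → Closed V t → ∀ {a v} → Anc t a v → V v ≡ true → V a ≡ true
closed-anc V c {a} p Vv with V a in Va
... | true = refl
... | false = let (h , m , q) = cut-anc V p Va in ⊥-elim (bool-clash (All.lookup c m (anc-∈ q)) Vv)

anc-closed : ∀ {n} V (t : Tree n) → (∀ {a y} → Anc t a y → V y ≡ true → V a ≡ true) → Closed V t
anc-closed V t up = All.tabulate λ m {y} q → untouched m q
  where
  untouched : ∀ {h y} → h ∈ cut V t → y ∈ₜ h → V y ≡ false
  untouched {y = y} m q with V y in Vy
  ... | false = refl
  ... | true = let (a , Va , an) = cut-hang V t m q in ⊥-elim (bool-clash Va (up an Vy))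

same-anc : ∀ {n} V {t t′ : Tree n} → cut V t ≡ cut V t′ → ∀ {a b} → Anc t a b → V a ≡ false → Anc t′ a b
same-anc V {t′ = t′} e p Va = let (h , m , q) = cut-anc V p Va in anc-cut V t′ (subst (h ∈_) e m) q

cut-cong : ∀ {n} V W (t : Tree n) → (∀ y → V y ≡ W y) → cut V t ≡ cut W t
cut-cong V W leaf V≗W = refl
cut-cong V W (node l k r) V≗W rewrite V≗W k with W k
... | true = cong₂ _++_ (cut-cong V W l V≗W) (cut-cong V W r V≗W)
... | false = refl

closed-cong : ∀ {n} V W {t : Tree n} → (∀ y → V y ≡ W y) → Closed V t → Closed W t
closed-cong V W {t} V≗W c =
  anc-closed W t λ {a} {y} an Wy → trans (sym (V≗W a)) (closed-anc V c an (trans (V≗W y) Wy))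

untouched-cut : ∀ {n} V (t : Tree n) → Untouched V t → cut V t ≡ t ∷ []
untouched-cut V leaf u = refl
untouched-cut V (node l k r) u rewrite u here = refl

untouched-closed : ∀ {n} V (t : Tree n) → Untouched V t → Closed V t
untouched-closed V t u rewrite untouched-cut V t u = u ∷ []

closed-all : ∀ {n} (t : Tree n) → Closed (λ _ → true) t
closed-all t = anc-closed _ t (λ _ _ → refl)

_⊆ᵇ_ : ∀ {n} → (Fin n → Bool) → (Fin n → Bool) → Set
V ⊆ᵇ W = ∀ y → V y ≡ true → W y ≡ true

cut-mono : ∀ {n} V W (t : Tree n) → V ⊆ᵇ W → cut W t ≡ concatMap (cut W) (cut V t)
cut-mono V W leaf V⊆W = refl
cut-mono V W (node l k r) V⊆W with V k in Vk
... | true rewrite V⊆W k Vk =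
  trans (cong₂ _++_ (cut-mono V W l V⊆W) (cut-mono V W r V⊆W)) (sym (concatMap-++ (cut W) (cut V l) (cut V r)))
... | false = sym (++-identityʳ (cut W (node l k r)))

_+ᵏ_ : ∀ {n} → (Fin n → Bool) → Fin n → Fin n → Bool
(V +ᵏ x) y = V y ∨ ⌊ y ≟ x ⌋

⊆-+ᵏ : ∀ {n} (V : Fin n → Bool) x → V ⊆ᵇ (V +ᵏ x)
⊆-+ᵏ V x y Vy rewrite Vy = refl

+ᵏ-self : ∀ {n} (V : Fin n → Bool) x → (V +ᵏ x) x ≡ true
+ᵏ-self V x rewrite ≟-refl x = ∨-zeroʳ (V x)

closed-extend : ∀ {n} V (t : Tree n) {x} → Closed V t →
  (∀ {a} → Anc t a x → a ≢ x → V a ≡ true) → Closed (V +ᵏ x) t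
closed-extend V t {x} c above = anc-closed (V +ᵏ x) t up
  where
  up : ∀ {a y} → Anc t a y → (V +ᵏ x) y ≡ true → (V +ᵏ x) a ≡ true
  up {a} {y} an Vxy with V y in Vy
  ... | true = ⊆-+ᵏ V x a (closed-anc V c an Vy)
  ... | false with a ≟ x
  ...   | yes refl = ∨-zeroʳ (V x)
  ...   | no a≢x rewrite above (subst (Anc t a) (≟-true Vxy) an) a≢x = refl

-- One operation preserves the cut of the tree below the visited nodes.
--
-- During an operation that started on tree T and has visited the key set V,
-- the invariant Inv below holds: the cursor and the path above it are
-- visited, the visited part is a top part of the current tree, the current
-- tree is still a BST on [n], and its cut below V is the cut of T.

fkey : ∀ {n} → Frame n → Fin n
fkey (wentL p _) = p
fkey (wentR _ p) = p

PathIn : ∀ {n} → (Fin n → Bool) → List (Frame n) → Set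
PathIn V fs = All (λ f → V (fkey f) ≡ true) fs

searchTree-ctx : ∀ {n} fs {t : Tree n} → SearchTree (plugCtx fs t) → SearchTree t
searchTree-ctx [] st = st
searchTree-ctx (wentL p r ∷ fs) st with searchTree-ctx fs st
... | nodeS sl _ _ _ = sl
searchTree-ctx (wentR l p ∷ fs) st with searchTree-ctx fs st
... | nodeS _ sr _ _ = sr

anc-ctx : ∀ {n} (V : Fin n → Bool) fs {t : Tree n} {x a} → PathIn V fs → SearchTree (plugCtx fs t) →
  x ∈ₜ t → Anc (plugCtx fs t) a x → V a ≡ true ⊎ Anc t a x
anc-ctx V [] _ _ _ an = inj₂ an
anc-ctx V (wentL k r ∷ fs) (Vk ∷ path) st p an with anc-ctx V fs path st (inl p) an
... | inj₁ Va = inj₁ Va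
... | inj₂ (root _) = inj₁ Vk
... | inj₂ (viaL an′) = inj₂ an′
... | inj₂ (viaR an′) with searchTree-ctx fs st
...   | nodeS _ _ l<k k<r = ⊥-elim (ℕP.<-asym (l<k p) (k<r (anc-∈ an′)))
anc-ctx V (wentR l k ∷ fs) (Vk ∷ path) st p an with anc-ctx V fs path st (inr p) an
... | inj₁ Va = inj₁ Va
... | inj₂ (root _) = inj₁ Vk
... | inj₂ (viaR an′) = inj₂ an′
... | inj₂ (viaL an′) with searchTree-ctx fs st
...   | nodeS _ _ l<k k<r = ⊥-elim (ℕP.<-asym (l<k (anc-∈ an′)) (k<r p))

path-ancestors : ∀ {n} (V : Fin n → Bool) fs {l x r} → PathIn V fs → SearchTree (plugCtx fs (node l x r)) →
  ∀ {a} → Anc (plugCtx fs (node l x r)) a x → a ≢ x → V a ≡ true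
path-ancestors V fs path st an a≢x with anc-ctx V fs path st here an | searchTree-ctx fs st
... | inj₁ Va | _ = Va
... | inj₂ (root _) | _ = ⊥-elim (a≢x refl)
... | inj₂ (viaL an′) | nodeS _ _ l<x _ = ⊥-elim (ℕP.<-irrefl refl (l<x (anc-∈ an′)))
... | inj₂ (viaR an′) | nodeS _ _ _ x<r = ⊥-elim (ℕP.<-irrefl refl (x<r (anc-∈ an′)))

cut-ctx-cong : ∀ {n} (V : Fin n → Bool) fs {t t′ : Tree n} → PathIn V fs → cut V t ≡ cut V t′ →
  cut V (plugCtx fs t) ≡ cut V (plugCtx fs t′)
cut-ctx-cong V [] _ e = e
cut-ctx-cong V (wentL k r ∷ fs) (Vk ∷ path) e = cut-ctx-cong V fs path (frame Vk)
  where
  frame : V k ≡ true → cut V (node _ k r) ≡ cut V (node _ k r)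
  frame Vk rewrite Vk = cong (_++ cut V r) e
cut-ctx-cong V (wentR l k ∷ fs) (Vk ∷ path) e = cut-ctx-cong V fs path (frame Vk)
  where
  frame : V k ≡ true → cut V (node l k _) ≡ cut V (node l k _)
  frame Vk rewrite Vk = cong (cut V l ++_) e

inorder-ctx-cong : ∀ {n} fs {t t′ : Tree n} → inorder t ≡ inorder t′ → inorder (plugCtx fs t) ≡ inorder (plugCtx fs t′)
inorder-ctx-cong [] e = e
inorder-ctx-cong (wentL k r ∷ fs) e = inorder-ctx-cong fs (cong (_++ (k ∷ inorder r)) e)
inorder-ctx-cong (wentR l k ∷ fs) e = inorder-ctx-cong fs (cong (λ z → inorder l ++ (k ∷ z)) e)

record Inv {n} (V : Fin n → Bool) (T : Tree n) (z : Zipper n) : Set where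
  constructor inv
  field
    path   : PathIn V (Zipper.ctx z)
    cursor : All (λ k → V k ≡ true) (cursorKey z)
    cutE   : cut V (plug z) ≡ cut V T
    closed : Closed V (plug z)
    bst    : IsBSTOn (plug z)

inv-cong : ∀ {n} V W {T : Tree n} {z} → (∀ y → V y ≡ W y) → Inv V T z → Inv W T z
inv-cong V W {T} {z} V≗W (inv path cur ce cl bs) =
  inv (All.map (λ {f} e → trans (sym (V≗W (fkey f))) e) path) (All.map (λ {k} e → trans (sym (V≗W k)) e) cur)
      (trans (sym (cut-cong V W (plug z) V≗W)) (trans ce (cut-cong V W T V≗W))) (closed-cong V W {plug z} V≗W cl) bs

inv-descend : ∀ {n} V (T : Tree n) f fs {a x b} →
  Inv V T (zip (plugFrame f (node a x b)) fs) → Inv (V +ᵏ x) T (zip (node a x b) (f ∷ fs))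
inv-descend V T f fs {x = x} I = inv (⊆-+ᵏ V x _ Vk ∷ All.map (λ {g} → ⊆-+ᵏ V x (fkey g)) path)
  (+ᵏ-self V x ∷ [])
  (begin
    cut (V +ᵏ x) P                           ≡⟨ cut-mono V (V +ᵏ x) P (⊆-+ᵏ V x) ⟩
    concatMap (cut (V +ᵏ x)) (cut V P)       ≡⟨ cong (concatMap (cut (V +ᵏ x))) cutE ⟩
    concatMap (cut (V +ᵏ x)) (cut V T)       ≡⟨ cut-mono V (V +ᵏ x) T (⊆-+ᵏ V x) ⟨
    cut (V +ᵏ x) T                           ∎)
  (closed-extend V P closed (path-ancestors V (f ∷ fs) (Vk ∷ path) (bstOn⇒SearchTree P bst)))
  bst
  where
  open Inv I
  open ≡-Reasoning
  P = plugCtx fs (plugFrame f (node _ x _))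
  parent-visited : ∀ g {c gs} → All (λ k → V k ≡ true) (cursorKey (zip (plugFrame g c) gs)) → V (fkey g) ≡ true
  parent-visited (wentL _ _) (Vk ∷ []) = Vk
  parent-visited (wentR _ _) (Vk ∷ []) = Vk
  Vk : V (fkey f) ≡ true
  Vk = parent-visited f cursor

inv-rotate : ∀ {n} V (T : Tree n) {z z′} → Inv V T z → step rotate z ≡ just z′ → Inv V T z′
inv-rotate V T {zip (node a x b) (wentL p c ∷ fs)} (inv (Vp ∷ path) (Vx ∷ []) ce cl bs) refl =
  inv path (Vx ∷ []) (trans ce₀ ce) (subst (All (Untouched V)) (sym ce₀) cl) (trans (inorder-ctx-cong fs io) bs)
  where
  e₀ : cut V (node a x (node b p c)) ≡ cut V (node (node a x b) p c)
  e₀ rewrite Vx | Vp = sym (++-assoc (cut V a) (cut V b) (cut V c))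
  ce₀ = cut-ctx-cong V fs path e₀
  io = sym (++-assoc (inorder a) (x ∷ inorder b) (p ∷ inorder c))
inv-rotate V T {zip (node b x c) (wentR a p ∷ fs)} (inv (Vp ∷ path) (Vx ∷ []) ce cl bs) refl =
  inv path (Vx ∷ []) (trans ce₀ ce) (subst (All (Untouched V)) (sym ce₀) cl) (trans (inorder-ctx-cong fs io) bs)
  where
  e₀ : cut V (node (node a p b) x c) ≡ cut V (node a p (node b x c))
  e₀ rewrite Vx | Vp = ++-assoc (cut V a) (cut V b) (cut V c)
  ce₀ = cut-ctx-cong V fs path e₀
  io = ++-assoc (inorder a) (p ∷ inorder b) (x ∷ inorder c)

∈ᵇ-++ : ∀ {n} (y : Fin n) xs ys → (y ∈ᵇ (xs ++ ys)) ≡ ((y ∈ᵇ xs) ∨ (y ∈ᵇ ys))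
∈ᵇ-++ y [] ys = refl
∈ᵇ-++ y (x ∷ xs) ys = trans (cong (⌊ y ≟ x ⌋ ∨_) (∈ᵇ-++ y xs ys)) (sym (∨-assoc ⌊ y ≟ x ⌋ (y ∈ᵇ xs) (y ∈ᵇ ys)))

absorb : ∀ {n} (V : Fin n → Bool) {ks} → All (λ k → V k ≡ true) ks → ∀ y → (V y ∨ (y ∈ᵇ ks)) ≡ V y
absorb V [] y = ∨-identityʳ (V y)
absorb V {k ∷ ks} (Vk ∷ Vks) y with y ≟ k
... | yes refl rewrite Vk = refl
... | no _ = absorb V Vks y

inv-absorb : ∀ {n} V (T : Tree n) {z} → Inv V T z → Inv (λ y → V y ∨ (y ∈ᵇ cursorKey z)) T z
inv-absorb V T I = inv-cong V _ (λ y → sym (absorb V (Inv.cursor I) y)) I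

step-inv : ∀ {n} V (T : Tree n) m z {z₁} → Inv V T z → step m z ≡ just z₁ →
  Inv (λ y → V y ∨ (y ∈ᵇ cursorKey z₁)) T z₁
step-inv V T toParent (zip t (wentL p r ∷ fs)) (inv (Vp ∷ path) _ ce cl bs) refl =
  inv-absorb V T (inv path (Vp ∷ []) ce cl bs)
step-inv V T toParent (zip t (wentR l p ∷ fs)) (inv (Vp ∷ path) _ ce cl bs) refl =
  inv-absorb V T (inv path (Vp ∷ []) ce cl bs)
step-inv V T toLeft (zip (node (node a x b) k r) fs) I refl =
  inv-cong (V +ᵏ x) _ (λ y → cong (V y ∨_) (sym (∨-identityʳ _))) (inv-descend V T (wentL k r) fs I)
step-inv V T toRight (zip (node l k (node a x b)) fs) I refl =
  inv-cong (V +ᵏ x) _ (λ y → cong (V y ∨_) (sym (∨-identityʳ _))) (inv-descend V T (wentR l k) fs I)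
step-inv V T rotate z I e = inv-absorb V T (inv-rotate V T I e)

run-inv : ∀ {n} V (T : Tree n) z ms {z′ vs} → Inv V T z → runSteps z ms ≡ just (z′ , vs) →
  Inv (λ y → V y ∨ (y ∈ᵇ vs)) T z′
run-inv V T z [] I refl = inv-cong V _ (λ y → sym (∨-identityʳ (V y))) I
run-inv V T z (m ∷ ms) I eq with step m z in e₁
run-inv V T z (m ∷ ms) I () | nothing
... | just z₁ with runSteps z₁ ms in e₂
run-inv V T z (m ∷ ms) I () | just z₁ | nothing
run-inv V T z (m ∷ ms) I refl | just z₁ | just (z₂ , vs₂) =
  inv-cong _ _ (λ y → trans (∨-assoc (V y) _ _) (cong (V y ∨_) (sym (∈ᵇ-++ y (cursorKey z₁) vs₂))))
    (run-inv _ T z₁ ms (step-inv V T m z I e₁) e₂)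

init-inv : ∀ {n} (T : Tree n) → IsBSTOn T → Inv (λ y → y ∈ᵇ cursorKey (atRoot T)) T (atRoot T)
init-inv leaf bs = inv [] [] refl (untouched-closed _ leaf (λ ())) bs
init-inv (node l k r) bs = inv [] (root-visited ∷ []) refl
  (closed-cong (none +ᵏ k) _ {T} (λ y → sym (∨-identityʳ _))
    (closed-extend none T (untouched-closed none T (λ _ → refl)) (path-ancestors none [] [] (bstOn⇒SearchTree T bs))))
  bs
  where
  T = node l k r
  none : Fin _ → Bool
  none _ = false
  root-visited : (⌊ k ≟ k ⌋ ∨ false) ≡ true
  root-visited rewrite ≟-refl k = refl

operation-facts : ∀ {n} (T : Tree n) ms {z vs} → IsBSTOn T → runSteps (atRoot T) ms ≡ just (z , vs) →
  let S = λ y → y ∈ᵇ (cursorKey (atRoot T) ++ vs) in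
  cut S T ≡ cut S (plug z) × Closed S (plug z) × IsBSTOn (plug z)
operation-facts T ms {z} {vs} bs e = sym (Inv.cutE I) , Inv.closed I , Inv.bst I
  where
  I = inv-cong _ (λ y → y ∈ᵇ (cursorKey (atRoot T) ++ vs)) (λ y → sym (∈ᵇ-++ y (cursorKey (atRoot T)) vs))
        (run-inv _ T (atRoot T) ms (init-inv T bs) e)

data At {A : Set} : List A → ℕ → A → Set where
  atZ : ∀ {x xs} → At (x ∷ xs) 0 x
  atS : ∀ {x xs t y} → At xs t y → At (x ∷ xs) (suc t) y

at-tabulate : ∀ {m} {A : Set} (f : Fin m → A) (i : Fin m) → At (tabulate f) (toℕ i) (f i)
at-tabulate f F.zero = atZ
at-tabulate f (F.suc i) = atS (at-tabulate (f ∘ F.suc) i)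

at-tabulate⁻ : ∀ {m} {A : Set} (f : Fin m → A) {t y} → At (tabulate f) t y → ∃ λ i → toℕ i ≡ t × y ≡ f i
at-tabulate⁻ {suc m} f atZ = F.zero , refl , refl
at-tabulate⁻ {suc m} f (atS p) = let (i , e , e′) = at-tabulate⁻ (f ∘ F.suc) p in F.suc i , cong suc e , e′

record Execution {n} (m : ℕ) (T₀ : Tree n) : Set where
  field
    tree    : ℕ → Tree n
    visited : ℕ → List (Fin n)
    tree₀   : tree 0 ≡ T₀
    bst     : ∀ i → i ℕ.≤ m → IsBSTOn (tree i)
    cutE    : ∀ i → i ℕ.< m → cut (_∈ᵇ visited i) (tree i) ≡ cut (_∈ᵇ visited i) (tree (suc i))
    closed  : ∀ i → i ℕ.< m → Closed (_∈ᵇ visited i) (tree (suc i))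

execution-∷ : ∀ {n m} {T T′ : Tree n} (vs₀ : List (Fin n)) → IsBSTOn T →
  cut (_∈ᵇ vs₀) T ≡ cut (_∈ᵇ vs₀) T′ → Closed (_∈ᵇ vs₀) T′ → Execution m T′ → Execution (suc m) T
execution-∷ {n} {m} {T} vs₀ bs cut₀ closed₀ E = record
  { tree = tree′ ; visited = visited′ ; tree₀ = refl ; bst = bst′ ; cutE = cutE′ ; closed = closed′ }
  where
  open Execution E
  tree′ : ℕ → Tree n
  tree′ zero = T
  tree′ (suc i) = tree i
  visited′ : ℕ → List (Fin n)
  visited′ zero = vs₀
  visited′ (suc i) = visited i
  bst′ : ∀ i → i ℕ.≤ suc m → IsBSTOn (tree′ i)
  bst′ zero _ = bs
  bst′ (suc i) (s≤s p) = bst i p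
  cutE′ : ∀ i → i ℕ.< suc m → cut (_∈ᵇ visited′ i) (tree′ i) ≡ cut (_∈ᵇ visited′ i) (tree′ (suc i))
  cutE′ zero _ = trans cut₀ (cong (cut _) (sym tree₀))
  cutE′ (suc i) (s≤s p) = cutE i p
  closed′ : ∀ i → i ℕ.< suc m → Closed (_∈ᵇ visited′ i) (tree′ (suc i))
  closed′ zero _ = subst (Closed _) (sym tree₀) closed₀
  closed′ (suc i) (s≤s p) = closed i p

execution-of : ∀ {n} (T : Tree n) xs mss {c} → IsBSTOn T → serveCost T xs mss ≡ just c →
  Σ (Execution (length xs) T) λ E → (∀ {t x} → At xs t x → (x ∈ᵇ Execution.visited E t) ≡ true) ×
     c ≡ sum {length xs} (λ t → distinctCount (Execution.visited E (toℕ t)))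
execution-of T [] [] bs refl =
  record { tree = λ _ → T ; visited = λ _ → [] ; tree₀ = refl ; bst = λ _ _ → bs ; cutE = λ _ () ; closed = λ _ () } ,
  (λ ()) , refl
execution-of T [] (_ ∷ _) bs ()
execution-of T (_ ∷ _) [] bs ()
execution-of T (x ∷ xs) (ms ∷ mss) bs eq with runSteps (atRoot T) ms in e₁
execution-of T (x ∷ xs) (ms ∷ mss) bs () | nothing
... | just (z , vs) with x ∈ᵇ (cursorKey (atRoot T) ++ vs) in e₂
execution-of T (x ∷ xs) (ms ∷ mss) bs () | just (z , vs) | false
... | true with serveCost (plug z) xs mss in e₃
execution-of T (x ∷ xs) (ms ∷ mss) bs () | just (z , vs) | true | nothing
execution-of T (x ∷ xs) (ms ∷ mss) bs refl | just (z , vs) | true | just c′ with operation-facts T ms bs e₁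
... | cut₀ , closed₀ , bst₀ with execution-of (plug z) xs mss bst₀ e₃
... | E , accessed , cost =
  execution-∷ _ bs cut₀ closed₀ E , (λ { atZ → e₂ ; (atS p) → accessed p }) ,
  cong (distinctCount (cursorKey (atRoot T) ++ vs) +_) cost

-- The geometric view: arborally satisfied point sets.

-- A point set in the grid [m] × [n] (time × key).
PointSet : ℕ → ℕ → Set
PointSet m n = Fin m → Fin n → Bool

InRectangle : ∀ {m n} → PointSet m n → Fin m → Fin n → Fin m → Fin n → Set
InRectangle Q t₁ k₁ t₂ k₂ = ∃ λ t → ∃ λ k →
  Q t k ≡ true × Between t₁ t₂ t × Between k₁ k₂ k × ¬ (t ≡ t₁ × k ≡ k₁) × ¬ (t ≡ t₂ × k ≡ k₂)

Satisfied : ∀ {m n} → PointSet m n → Set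
Satisfied {m} {n} Q = ∀ (t₁ t₂ : Fin m) (k₁ k₂ : Fin n) → Q t₁ k₁ ≡ true → Q t₂ k₂ ≡ true →
  t₁ ≢ t₂ → k₁ ≢ k₂ → InRectangle Q t₁ k₁ t₂ k₂

ind : Bool → ℕ
ind true = 1
ind false = 0

size : ∀ {m n} → PointSet m n → ℕ
size Q = sum (λ t → sum (λ k → ind (Q t k)))

SatisfiedSuperset : ∀ {m n} → (Fin m → Fin n) → ℕ → Set
SatisfiedSuperset {m} {n} f c = Σ (PointSet m n) λ Q → Satisfied Q × (∀ t → Q t (f t) ≡ true) × size Q ≡ c

transpose : ∀ {n} (f g : Fin n → Fin n) c → (∀ t → f (g t) ≡ t) →
  SatisfiedSuperset f c → SatisfiedSuperset g c
transpose {n} f g c fg (Q , sat , access , sz) = Qᵀ , satᵀ , accessᵀ , trans (∑-comm (λ t k → ind (Q k t))) sz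
  where
  Qᵀ : PointSet n n
  Qᵀ t k = Q k t
  accessᵀ : ∀ t → Qᵀ t (g t) ≡ true
  accessᵀ t = subst (λ u → Q (g t) u ≡ true) (fg t) (access (g t))
  satᵀ : Satisfied Qᵀ
  satᵀ t₁ t₂ k₁ k₂ q₁ q₂ t₁≢t₂ k₁≢k₂ with sat k₁ k₂ t₁ t₂ q₁ q₂ k₁≢k₂ t₁≢t₂
  ... | t , k , q , bt , bk , c₁ , c₂ = k , t , q , bk , bt , (λ (x , y) → c₁ (y , x)) , (λ (x , y) → c₂ (y , x))

reflect : ∀ {m n} (f g : Fin m → Fin n) c → (∀ t → g t ≡ f (opposite t)) →
  SatisfiedSuperset f c → SatisfiedSuperset g c
reflect {m} {n} f g c g≗f∘opp (Q , sat , access , sz) =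
  Qʳ , satʳ , accessʳ , trans (sym (∑-permute (λ t → sum (λ k → ind (Q t k))) Perm.reverse)) sz
  where
  Qʳ : PointSet m n
  Qʳ t k = Q (opposite t) k
  accessʳ : ∀ t → Qʳ t (g t) ≡ true
  accessʳ t = subst (λ u → Q (opposite t) u ≡ true) (sym (g≗f∘opp t)) (access (opposite t))
  opp-inj : ∀ {t t′} → opposite t ≡ opposite t′ → t ≡ t′
  opp-inj {t} {t′} e = trans (sym (FP.opposite-involutive t)) (trans (cong opposite e) (FP.opposite-involutive t′))
  satʳ : Satisfied Qʳ
  satʳ t₁ t₂ k₁ k₂ q₁ q₂ t₁≢t₂ k₁≢k₂ with sat (opposite t₁) (opposite t₂) k₁ k₂ q₁ q₂ (t₁≢t₂ ∘ opp-inj) k₁≢k₂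
  ... | t , k , q , bt , bk , c₁ , c₂ =
    opposite t , k , subst (λ u → Q u k ≡ true) (sym (FP.opposite-involutive t)) q , between-opposite bt , bk ,
    (λ (x , y) → c₁ (opp-swap x , y)) , (λ (x , y) → c₂ (opp-swap x , y))
    where
    opp-swap : ∀ {u} → opposite t ≡ u → t ≡ opposite u
    opp-swap x = trans (sym (FP.opposite-involutive t)) (cong opposite x)

full : ∀ {m n} (f : Fin m → Fin n) → SatisfiedSuperset f (size {m} {n} (λ _ _ → true))
full f = (λ _ _ → true) , sat , (λ _ → refl) , refl
  where
  sat : Satisfied (λ _ _ → true)
  sat t₁ t₂ k₁ k₂ _ _ t₁≢t₂ k₁≢k₂ =
    t₁ , k₂ , refl , between-left t₁ t₂ , between-sym (between-left k₂ k₁) ,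
    (λ (_ , y) → k₁≢k₂ (sym y)) , (λ (x , _) → t₁≢t₂ x)

satisfied? : ∀ {m n} (Q : PointSet m n) → Dec (Satisfied Q)
satisfied? Q = FP.all? λ t₁ → FP.all? λ t₂ → FP.all? λ k₁ → FP.all? λ k₂ →
  (Q t₁ k₁ BP.≟ true) →-dec (Q t₂ k₂ BP.≟ true) →-dec ¬? (t₁ FP.≟ t₂) →-dec ¬? (k₁ FP.≟ k₂) →-dec
  FP.any? λ t → FP.any? λ k → (Q t k BP.≟ true) ×-dec between? t₁ t₂ t ×-dec between? k₁ k₂ k ×-dec
    ¬? ((t FP.≟ t₁) ×-dec (k FP.≟ k₁)) ×-dec ¬? ((t FP.≟ t₂) ×-dec (k FP.≟ k₂))

Searchable : (A : Set) → (A → A → Set) → Set₁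
Searchable A R = ∀ (P : A → Set) → (∀ a → Dec (P a)) → (∀ {a b} → R a b → P a → P b) → Dec (∃ P)

searchable-Bool : Searchable Bool _≡_
searchable-Bool P P? _ with P? true | P? false
... | yes p | _ = yes (true , p)
... | no _ | yes p = yes (false , p)
... | no ¬t | no ¬f = no λ { (true , p) → ¬t p ; (false , p) → ¬f p }

searchable-Fin→ : ∀ {A : Set} {R : A → A → Set} → (∀ {a} → R a a) → Searchable A R →
  ∀ k → Searchable (Fin k → A) (λ f g → ∀ i → R (f i) (g i))
searchable-Fin→ refl-R search-A zero P P? resp with P? (λ ())
... | yes p = yes (_ , p)
... | no ¬p = no λ (f , p) → ¬p (resp (λ ()) p)
searchable-Fin→ refl-R search-A (suc k) P P? resp
  with search-A (λ a → ∃ λ g → P (a Vector.∷ g))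
         (λ a → searchable-Fin→ refl-R search-A k (P ∘ (a Vector.∷_)) (P? ∘ (a Vector.∷_))
                  (λ r → resp (λ { F.zero → refl-R ; (F.suc i) → r i })))
         (λ r (g , p) → g , resp (λ { F.zero → r ; (F.suc i) → refl-R }) p)
... | yes (a , g , p) = yes (_ , p)
... | no ¬p = no λ (f , p) → ¬p (f F.zero , f ∘ F.suc , resp (λ { F.zero → refl-R ; (F.suc i) → refl-R }) p)

satisfiedSuperset? : ∀ {m n} (f : Fin m → Fin n) c → Dec (SatisfiedSuperset f c)
satisfiedSuperset? {m} {n} f c =
  searchable-Fin→ (λ _ → refl) (searchable-Fin→ refl searchable-Bool n) m _
    (λ Q → satisfied? Q ×-dec FP.all? (λ t → Q t (f t) BP.≟ true) ×-dec (size Q ℕP.≟ c))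
    λ {Q} {Q′} Q≗Q′ (sat , access , sz) →
      satisfied-cong Q≗Q′ sat , (λ t → trans (sym (Q≗Q′ t (f t))) (access t)) ,
      trans (sym (sum-cong-≗ λ t → sum-cong-≗ λ k → cong ind (Q≗Q′ t k))) sz
  where
  satisfied-cong : ∀ {Q Q′ : PointSet m n} → (∀ t k → Q t k ≡ Q′ t k) → Satisfied Q → Satisfied Q′
  satisfied-cong Q≗Q′ sat t₁ t₂ k₁ k₂ q₁ q₂ t₁≢t₂ k₁≢k₂
    with sat t₁ t₂ k₁ k₂ (trans (Q≗Q′ t₁ k₁) q₁) (trans (Q≗Q′ t₂ k₂) q₂) t₁≢t₂ k₁≢k₂
  ... | t , k , q , rest = t , k , trans (sym (Q≗Q′ t k)) q , rest

Least : (ℕ → Set) → ℕ → Set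
Least D c = D c × (∀ c′ → D c′ → c ℕ.≤ c′)

least : (D : ℕ → Set) → (∀ c → Dec (D c)) → ∀ c₀ → D c₀ → ∃ (Least D)
least D D? = <-rec (λ c₀ → D c₀ → ∃ (Least D)) below
  where
  below : ∀ c₀ → (∀ {c} → c ℕ.< c₀ → D c → ∃ (Least D)) → D c₀ → ∃ (Least D)
  below c₀ rec d with ℕP.anyUpTo? D? c₀
  ... | yes (c , c<c₀ , dc) = rec c<c₀ dc
  ... | no none = c₀ , d , λ c′ dc′ → ℕP.≮⇒≥ (λ c′<c₀ → none (c′ , c′<c₀ , dc′))

-- Forward direction: the visits of an execution form a satisfied set.

VisitBetween : ∀ {n} → (ℕ → Fin n → Bool) → ℕ → ℕ → Fin n → Fin n → Set
VisitBetween S i j a b = ∃ λ t → ∃ λ k →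
  i ℕ.≤ t × t ℕ.≤ j × S t k ≡ true × Between a b k × ¬ (t ≡ i × k ≡ a) × ¬ (t ≡ j × k ≡ b)

module Forward {n m} {T₀ : Tree n} (E : Execution m T₀) where
  open Execution E

  S : ℕ → Fin n → Bool
  S t y = y ∈ᵇ visited t

  closed-before : ∀ j → j ℕ.< m → Closed (S j) (tree j)
  closed-before j j<m = subst (All (Untouched (S j))) (sym (cutE j j<m)) (closed j j<m)

  persists : ∀ d {t a b} → t + d ℕ.≤ m → Anc (tree t) a b →
    (∃ λ t′ → t ℕ.≤ t′ × t′ ℕ.< t + d × S t′ a ≡ true) ⊎ Anc (tree (t + d)) a b
  persists zero {t} _ an = inj₂ (subst (λ u → Anc (tree u) _ _) (sym (ℕP.+-identityʳ t)) an)
  persists (suc d) {t} {a} {b} t+d<m an with S t a in Sa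
  ... | true = inj₁ (t , ℕP.≤-refl , ℕP.m<m+n t (s≤s z≤n) , Sa)
  ... | false with persists d {suc t} (subst (ℕ._≤ m) (ℕP.+-suc t d) t+d<m)
                     (same-anc (S t) (cutE t (ℕP.<-≤-trans (ℕP.m<m+n t (s≤s z≤n)) t+d<m)) an Sa)
  ...   | inj₁ (t′ , t<t′ , t′<t+d , St′) =
    inj₁ (t′ , ℕP.<⇒≤ t<t′ , subst (t′ ℕ.<_) (sym (ℕP.+-suc t d)) t′<t+d , St′)
  ...   | inj₂ an′ = inj₂ (subst (λ u → Anc (tree u) a b) (sym (ℕP.+-suc t d)) an′)

  -- Let c be the lowest common ancestor of a and b
  -- after operation i.  If c ≢ a then (i , c) is visited; otherwise a stays
  -- above b until it is visited at some time t′ < j, or else at time j.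
  rectangle : ∀ {i j a b} → i ℕ.< j → j ℕ.< m → S i a ≡ true → S j b ≡ true → a ≢ b → VisitBetween S i j a b
  rectangle {i} {j} {a} {b} i<j j<m Sa Sb a≢b with lca (bstOn⇒SearchTree _ bsts) (bstOn-∈ _ bsts a) (bstOn-∈ _ bsts b) a≢b
    where bsts = bst (suc i) (ℕP.≤-trans i<j (ℕP.<⇒≤ j<m))
  ... | c , c∈ab , ca , cb with c ≟ a
  ... | no c≢a = i , c , ℕP.≤-refl , ℕP.<⇒≤ i<j , closed-anc (S i) (closed i (ℕP.<-trans i<j j<m)) ca Sa , c∈ab ,
                 (λ (_ , c≡a) → c≢a c≡a) , (λ (i≡j , _) → ℕP.<-irrefl i≡j i<j)
  ... | yes refl with persists (j ∸ suc i) (ℕP.≤-trans (ℕP.≤-reflexive (ℕP.m+[n∸m]≡n i<j)) (ℕP.<⇒≤ j<m)) cb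
  ...   | inj₁ (t′ , i<t′ , t′<j , St′) =
    t′ , a , ℕP.<⇒≤ i<t′ , ℕP.<⇒≤ t′<j′ , St′ , between-left a b ,
    (λ (t′≡i , _) → ℕP.<-irrefl (sym t′≡i) i<t′) , (λ (t′≡j , _) → ℕP.<-irrefl t′≡j t′<j′)
    where t′<j′ = subst (t′ ℕ.<_) (ℕP.m+[n∸m]≡n i<j) t′<j
  ...   | inj₂ an =
    j , a , ℕP.<⇒≤ i<j , ℕP.≤-refl ,
    closed-anc (S j) (closed-before j j<m) (subst (λ u → Anc (tree u) a b) (ℕP.m+[n∸m]≡n i<j) an) Sb ,
    between-left a b , (λ (j≡i , _) → ℕP.<-irrefl (sym j≡i) i<j) , (λ (_ , a≡b) → a≢b a≡b)

  visits : ∀ M → PointSet M n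
  visits M t k = S (toℕ t) k

  visit-rectangle : ∀ {M} {i j : Fin M} {a b} → toℕ i ℕ.< toℕ j → VisitBetween S (toℕ i) (toℕ j) a b →
    InRectangle (visits M) i a j b
  visit-rectangle {M} {i} {j} i<j (t , k , i≤t , t≤j , Stk , bk , c₁ , c₂) =
    fromℕ< t<M , k , subst (λ u → S u k ≡ true) (sym e) Stk ,
    inj₁ (subst (toℕ i ℕ.≤_) (sym e) i≤t , subst (ℕ._≤ toℕ j) (sym e) t≤j) , bk ,
    (λ (x , y) → c₁ (trans (sym e) (cong toℕ x) , y)) , (λ (x , y) → c₂ (trans (sym e) (cong toℕ x) , y))
    where
    t<M = ℕP.≤-<-trans t≤j (FP.toℕ<n j)
    e = FP.toℕ-fromℕ< t<M

  visits-satisfied : ∀ {M} → M ℕ.≤ m → Satisfied (visits M)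
  visits-satisfied {M} M≤m t₁ t₂ k₁ k₂ q₁ q₂ t₁≢t₂ k₁≢k₂ with FP.<-cmp t₁ t₂
  ... | tri< lt _ _ = visit-rectangle lt (rectangle lt (ℕP.<-≤-trans (FP.toℕ<n t₂) M≤m) q₁ q₂ k₁≢k₂)
  ... | tri≈ _ e _ = ⊥-elim (t₁≢t₂ e)
  ... | tri> _ _ gt with visit-rectangle gt (rectangle gt (ℕP.<-≤-trans (FP.toℕ<n t₁) M≤m) q₂ q₁ (k₁≢k₂ ∘ sym))
  ...   | t , k , q , bt , bk , c₂ , c₁ = t , k , q , between-sym bt , between-sym bk , c₁ , c₂

countTrue-tabulate : ∀ {n k} (g : Fin k → Fin n) vs → countTrue (tabulate g) vs ≡ sum (λ i → ind (g i ∈ᵇ vs))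
countTrue-tabulate {k = zero} g vs = refl
countTrue-tabulate {k = suc k} g vs with g F.zero ∈ᵇ vs
... | true = cong suc (countTrue-tabulate (g ∘ F.suc) vs)
... | false = countTrue-tabulate (g ∘ F.suc) vs

-- The cost of a valid algorithm serving f is the size of a satisfied
-- superset of the access points: take Q t k = "operation t visits k".
forward : ∀ {m n} (f : Fin m → Fin n) c → Achievable (tabulate f) c → SatisfiedSuperset f c
forward {m} {n} f c (T , mss , bs , served) with execution-of T (tabulate f) mss bs served
... | E , accessed , cost = visits m , visits-satisfied (ℕP.≤-reflexive (sym L≡m)) , access , sz
  where
  open Execution E
  open Forward E
  L≡m : length (tabulate f) ≡ m
  L≡m = length-tabulate f
  access : ∀ t → visits m t (f t) ≡ true
  access t = accessed (at-tabulate f t)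
  count : ℕ → ℕ
  count t = distinctCount (visited t)
  sz : size (visits m) ≡ c
  sz = sym (begin
    c                                        ≡⟨ cost ⟩
    sum {length (tabulate f)} (count ∘ toℕ)  ≡⟨ cong (λ L → sum {L} (count ∘ toℕ)) L≡m ⟩
    sum {m} (count ∘ toℕ)                    ≡⟨ sum-cong-≗ {m} (λ t → countTrue-tabulate id (visited (toℕ t))) ⟩
    size (visits m)                          ∎)
    where open ≡-Reasoning

-- Backward direction, part 1: heaps and next touch times.

data Heap {n} (p : Fin n → ℕ) : Tree n → Set where
  leafH : Heap p leaf
  nodeH : ∀ {l k r} → Heap p l → Heap p r →
          (∀ {x} → x ∈ₜ l → p k ℕ.≤ p x) → (∀ {x} → x ∈ₜ r → p k ℕ.≤ p x) → Heap p (node l k r)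

heap-anc : ∀ {n} {p : Fin n → ℕ} {t a b} → Heap p t → Anc t a b → p a ℕ.≤ p b
heap-anc (nodeH _ _ _ _) (root here) = ℕP.≤-refl
heap-anc (nodeH _ _ k≤l _) (root (inl q)) = k≤l q
heap-anc (nodeH _ _ _ k≤r) (root (inr q)) = k≤r q
heap-anc (nodeH hl _ _ _) (viaL q) = heap-anc hl q
heap-anc (nodeH _ hr _ _) (viaR q) = heap-anc hr q

heap-cong : ∀ {n} {p p′ : Fin n → ℕ} {t} → (∀ {y} → y ∈ₜ t → p y ≡ p′ y) → Heap p t → Heap p′ t
heap-cong e leafH = leafH
heap-cong e (nodeH hl hr k≤l k≤r) =
  nodeH (heap-cong (e ∘ inl) hl) (heap-cong (e ∘ inr) hr)
    (λ q → subst₂ ℕ._≤_ (e here) (e (inl q)) (k≤l q)) (λ q → subst₂ ℕ._≤_ (e here) (e (inr q)) (k≤r q))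

sub-heap : ∀ {n} {p : Fin n → ℕ} {τ t} → Sub τ t → Heap p t → Heap p τ
sub-heap self h = h
sub-heap (underL s) (nodeH hl _ _ _) = sub-heap s hl
sub-heap (underR s) (nodeH _ hr _ _) = sub-heap s hr

data TopHeap {n} (V : Fin n → Bool) (p : Fin n → ℕ) : Tree n → Set where
  leafT : TopHeap V p leaf
  nodeT : ∀ {l k r} → TopHeap V p l → TopHeap V p r →
          (V k ≡ true → ∀ {x} → x ∈ₜ l → V x ≡ true → p k ℕ.≤ p x) →
          (V k ≡ true → ∀ {x} → x ∈ₜ r → V x ≡ true → p k ℕ.≤ p x) → TopHeap V p (node l k r)

sub-top : ∀ {n} {V} {p : Fin n → ℕ} {τ t} → Sub τ t → TopHeap V p t → TopHeap V p τ
sub-top self h = h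
sub-top (underL s) (nodeT hl _ _ _) = sub-top s hl
sub-top (underR s) (nodeT _ hr _ _) = sub-top s hr

untouched-top : ∀ {n} V (p : Fin n → ℕ) t → Untouched V t → TopHeap V p t
untouched-top V p leaf u = leafT
untouched-top V p (node l k r) u =
  nodeT (untouched-top V p l (u ∘ inl)) (untouched-top V p r (u ∘ inr))
    (λ Vk → ⊥-elim (bool-clash (u here) Vk)) (λ Vk → ⊥-elim (bool-clash (u here) Vk))

topHeap-all : ∀ {n} (p : Fin n → ℕ) {t} → TopHeap (λ _ → true) p t → Heap p t
topHeap-all p leafT = leafH
topHeap-all p (nodeT hl hr k≤l k≤r) =
  nodeH (topHeap-all p hl) (topHeap-all p hr) (λ q → k≤l refl q refl) (λ q → k≤r refl q refl)

-- Row i of a point set, with times as natural numbers (empty beyond m).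
row : ∀ {m n} → PointSet m n → ℕ → Fin n → Bool
row {zero} Q t k = false
row {suc m} Q zero k = Q F.zero k
row {suc m} Q (suc t) k = row (Q ∘ F.suc) t k

row-toℕ : ∀ {m n} (Q : PointSet m n) i k → row Q (toℕ i) k ≡ Q i k
row-toℕ {suc m} Q F.zero k = refl
row-toℕ {suc m} Q (F.suc i) k = row-toℕ (Q ∘ F.suc) i k

∸-<-suc : ∀ {i j} → i ℕ.< j → j ∸ i ≡ suc (j ∸ suc i)
∸-<-suc {zero} {suc j} _ = refl
∸-<-suc {suc i} {suc j} (s≤s p) = ∸-<-suc p

module NextTouch {m n} (Q : PointSet m n) where

  S : ℕ → Fin n → Bool
  S = row Q

  -- The first time ≥ i at which k is touched, scanning at most d rows; else i + d.
  scan : ℕ → ℕ → Fin n → ℕ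
  scan zero i k = i
  scan (suc d) i k = if S i k then i else scan d (suc i) k

  -- next i k : the first time ≥ i at which k is touched, or m if there is none.
  next : ℕ → Fin n → ℕ
  next i k = scan (m ∸ i) i k

  private
    scan-≥ : ∀ d i k → i ℕ.≤ scan d i k
    scan-≥ zero i k = ℕP.≤-refl
    scan-≥ (suc d) i k with S i k
    ... | true = ℕP.≤-refl
    ... | false = ℕP.≤-trans (ℕP.n≤1+n i) (scan-≥ d (suc i) k)

    scan-≤ : ∀ d i k → scan d i k ℕ.≤ i + d
    scan-≤ zero i k = ℕP.≤-reflexive (sym (ℕP.+-identityʳ i))
    scan-≤ (suc d) i k with S i k
    ... | true = ℕP.m≤m+n i (suc d)
    ... | false = subst (scan d (suc i) k ℕ.≤_) (sym (ℕP.+-suc i d)) (scan-≤ d (suc i) k)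

    scan-hit : ∀ d i k → scan d i k ℕ.< i + d → S (scan d i k) k ≡ true
    scan-hit zero i k lt = ⊥-elim (ℕP.<-irrefl (sym (ℕP.+-identityʳ i)) lt)
    scan-hit (suc d) i k lt with S i k in Sik
    ... | true = Sik
    ... | false = scan-hit d (suc i) k (subst (scan d (suc i) k ℕ.<_) (ℕP.+-suc i d) lt)

  next-≥ : ∀ i k → i ℕ.≤ next i k
  next-≥ i k = scan-≥ (m ∸ i) i k

  next-≤m : ∀ {i k} → i ℕ.≤ m → next i k ℕ.≤ m
  next-≤m {i} {k} i≤m = subst (next i k ℕ.≤_) (ℕP.m+[n∸m]≡n i≤m) (scan-≤ (m ∸ i) i k)

  next-touched : ∀ {i k} → i ℕ.≤ m → next i k ℕ.< m → S (next i k) k ≡ true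
  next-touched {i} {k} i≤m lt = scan-hit (m ∸ i) i k (subst (next i k ℕ.<_) (sym (ℕP.m+[n∸m]≡n i≤m)) lt)

  next-now : ∀ {i k} → i ℕ.< m → S i k ≡ true → next i k ≡ i
  next-now {i} {k} i<m Sik rewrite ∸-<-suc i<m | Sik = refl

  next-later : ∀ {i k} → i ℕ.< m → S i k ≡ false → next i k ≡ next (suc i) k
  next-later {i} {k} i<m Sik rewrite ∸-<-suc i<m | Sik = refl

  next-now⁻ : ∀ {i k} → i ℕ.< m → next i k ≡ i → S i k ≡ true
  next-now⁻ {i} {k} i<m e with S i k in Sik
  ... | true = refl
  ... | false = ⊥-elim (ℕP.<-irrefl (sym e) (subst (i ℕ.<_) (sym (next-later i<m Sik)) (next-≥ (suc i) k)))

  next-≤ : ∀ {i t k} → i ℕ.≤ t → t ℕ.< m → S t k ≡ true → next i k ℕ.≤ t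
  next-≤ {i} {t} i≤t = go (t ∸ i) (ℕP.m+[n∸m]≡n i≤t)
    where
    go : ∀ d {i t k} → i + d ≡ t → t ℕ.< m → S t k ≡ true → next i k ℕ.≤ t
    go zero {i} e t<m Stk rewrite ℕP.+-identityʳ i | e = ℕP.≤-reflexive (next-now t<m Stk)
    go (suc d) {i} {t} {k} e t<m Stk with S i k in Sik
    ... | true = ℕP.≤-trans (ℕP.≤-reflexive (next-now i<m Sik)) i≤t′
      where i≤t′ = subst (i ℕ.≤_) e (ℕP.m≤m+n i (suc d))
            i<m = ℕP.≤-<-trans i≤t′ t<m
    ... | false = ℕP.≤-trans (ℕP.≤-reflexive (next-later i<m Sik)) (go d (trans (sym (ℕP.+-suc i d)) e) t<m Stk)
      where i<m = ℕP.<-≤-trans (subst (i ℕ.<_) e (ℕP.m<m+n i (s≤s z≤n))) (ℕP.<⇒≤ t<m)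

  heap-closed : ∀ {i} (T : Tree n) → i ℕ.< m → Heap (next i) T → Closed (S i) T
  heap-closed {i} T i<m h = anc-closed (S i) T λ {a} {y} an Sy →
    next-now⁻ i<m (ℕP.≤-antisym (ℕP.≤-trans (heap-anc h an) (ℕP.≤-reflexive (next-now i<m Sy))) (next-≥ i a))

-- Backward direction, part 2: what satisfiedness says about next touch times.

module Touching {m n} (Q : PointSet m n) (sat : Satisfied Q) where
  open NextTouch Q

  satisfiedℕ : ∀ {i j a b} → i ℕ.< j → j ℕ.< m → S i a ≡ true → S j b ≡ true → a ≢ b → VisitBetween S i j a b
  satisfiedℕ {i} {j} {a} {b} i<j j<m Sa Sb a≢b
    with sat fi fj a b (trans (sym (row-toℕ Q fi a)) (subst (λ u → S u a ≡ true) (sym ei) Sa))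
                       (trans (sym (row-toℕ Q fj b)) (subst (λ u → S u b ≡ true) (sym ej) Sb))
                       (λ e → ℕP.<-irrefl (trans (sym ei) (trans (cong toℕ e) ej)) i<j) a≢b
    where
    i<m = ℕP.<-trans i<j j<m
    fi = fromℕ< i<m
    fj = fromℕ< j<m
    ei = FP.toℕ-fromℕ< i<m
    ej = FP.toℕ-fromℕ< j<m
  ... | t , k , Qtk , bt , bk , c₁ , c₂ =
    toℕ t , k , proj₁ (in-range bt) , proj₂ (in-range bt) , trans (row-toℕ Q t k) Qtk , bk ,
    (λ (x , y) → c₁ (FP.toℕ-injective (trans x (sym ei)) , y)) , (λ (x , y) → c₂ (FP.toℕ-injective (trans x (sym ej)) , y))
    where
    i<m = ℕP.<-trans i<j j<m
    ei = FP.toℕ-fromℕ< i<m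
    ej = FP.toℕ-fromℕ< j<m
    in-range : Between (fromℕ< i<m) (fromℕ< j<m) t → i ℕ.≤ toℕ t × toℕ t ℕ.≤ j
    in-range (inj₁ (x , y)) = subst (ℕ._≤ toℕ t) ei x , subst (toℕ t ℕ.≤_) ej y
    in-range (inj₂ (x , y)) =
      ⊥-elim (ℕP.<-irrefl refl (ℕP.<-≤-trans i<j (ℕP.≤-trans (subst (ℕ._≤ toℕ t) ej x) (subst (toℕ t ℕ.≤_) ei y))))

  -- The rectangle spanned by (i , s) and the next touch of y contains a
  -- point (t , k) with t > i; either k = s, or we recurse with y := k.
  touch-order : ∀ {i s y} → Acc ℕ._<_ (dist s y) → i ℕ.< m → S i s ≡ true → S i y ≡ false →
    (∀ {k} → Between s y k → k ≢ s → S i k ≡ false) → next (suc i) s ℕ.≤ next (suc i) y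
  touch-order {i} {s} {y} (acc smaller) i<m Ss Sy gap with m ℕP.≤? next (suc i) y
  ... | yes m≤ty = ℕP.≤-trans (next-≤m i<m) m≤ty
  ... | no m≰ty with satisfiedℕ (ℕP.<-≤-trans (ℕP.n<1+n i) (next-≥ (suc i) y)) ty<m Ss (next-touched i<m ty<m)
                                (λ s≡y → bool-clash Sy (subst (λ u → S i u ≡ true) s≡y Ss))
    where ty<m = ℕP.≰⇒> m≰ty
  ... | t , k , i≤t , t≤ty , Stk , bk , c₁ , c₂ with t ℕP.≟ i | k ≟ s
  ...   | yes refl | yes k≡s = ⊥-elim (c₁ (refl , k≡s))
  ...   | yes refl | no k≢s = ⊥-elim (bool-clash (gap bk k≢s) Stk)
  ...   | no t≢i | yes refl = ℕP.≤-trans (next-≤ i<t t<m Stk) t≤ty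
    where i<t = ℕP.≤∧≢⇒< i≤t (t≢i ∘ sym)
          t<m = ℕP.≤-<-trans t≤ty (ℕP.≰⇒> m≰ty)
  ...   | no t≢i | no k≢s with k ≟ y
  ...     | yes refl = ⊥-elim (ℕP.<-irrefl refl (ℕP.≤-<-trans (next-≤ i<t t<m Stk) (ℕP.≤∧≢⇒< t≤ty (λ e → c₂ (e , refl)))))
    where i<t = ℕP.≤∧≢⇒< i≤t (t≢i ∘ sym)
          t<m = ℕP.≤-<-trans t≤ty (ℕP.≰⇒> m≰ty)
  ...     | no k≢y = ℕP.≤-trans (touch-order (smaller (dist-between bk k≢y)) i<m Ss (gap bk k≢s)
                                   (λ bk′ → gap (between-trans bk bk′)))
                                (ℕP.≤-trans (next-≤ i<t t<m Stk) t≤ty)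
    where i<t = ℕP.≤∧≢⇒< i≤t (t≢i ∘ sym)
          t<m = ℕP.≤-<-trans t≤ty (ℕP.≰⇒> m≰ty)

  -- After operation i rearranges the keys touched at time i (a top part V of a
  -- search tree T′ on all keys) into a heap for next (i + 1) among themselves,
  -- and leaves the hanging subtrees heaps for next (i + 1), T′ is a heap.
  module Rebuilt {i} (i<m : i ℕ.< m) (T′ : Tree n) (st : SearchTree T′) (all∈ : ∀ z → z ∈ₜ T′)
                 (closedT′ : Closed (S i) T′) (top : TopHeap (S i) (next (suc i)) T′) where
    V = S i
    q = next (suc i)

    -- Between a touched node k and a key y below its untouched left child,
    -- every key other than k is untouched (it lies in that child).
    gap-left : ∀ {l₂ k₂ r₂ k r y} → Sub (node (node l₂ k₂ r₂) k r) T′ → V k₂ ≡ false → y ∈ₜ node l₂ k₂ r₂ →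
      ∀ {z} → Between k y z → z ≢ k → V z ≡ false
    gap-left s Vk₂ py (inj₁ (kz , zy)) z≢k with sub-search s st
    ... | nodeS _ _ y<k _ = ⊥-elim (ℕP.<-irrefl refl (ℕP.<-≤-trans (y<k py) (ℕP.≤-trans kz zy)))
    gap-left s Vk₂ py {z} (inj₂ (yz , zk)) z≢k with V z in Vz
    ... | false = refl
    ... | true = ⊥-elim (bool-clash Vk₂ (closed-anc V closedT′ (sub-anc (sub-left s) z∈) Vz))
      where z∈ = interval-left st s py (all∈ z) yz (ℕP.≤∧≢⇒< zk (z≢k ∘ FP.toℕ-injective))

    gap-right : ∀ {l k l₂ k₂ r₂ y} → Sub (node l k (node l₂ k₂ r₂)) T′ → V k₂ ≡ false → y ∈ₜ node l₂ k₂ r₂ →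
      ∀ {z} → Between k y z → z ≢ k → V z ≡ false
    gap-right s Vk₂ py (inj₂ (yz , zk)) z≢k with sub-search s st
    ... | nodeS _ _ _ k<y = ⊥-elim (ℕP.<-irrefl refl (ℕP.<-≤-trans (k<y py) (ℕP.≤-trans yz zk)))
    gap-right s Vk₂ py {z} (inj₁ (kz , zy)) z≢k with V z in Vz
    ... | false = refl
    ... | true = ⊥-elim (bool-clash Vk₂ (closed-anc V closedT′ (sub-anc (sub-right s) z∈) Vz))
      where z∈ = interval-right st s py (all∈ z) zy (ℕP.≤∧≢⇒< kz (z≢k ∘ sym ∘ FP.toℕ-injective))

    touched-above : ∀ {l k r} → Sub (node l k r) T′ → V k ≡ true → ∀ {y} → y ∈ₜ node l k r → V y ≡ false → q k ℕ.≤ q y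
    touched-above s Vk here Vy = ⊥-elim (bool-clash Vy Vk)
    touched-above {node l₂ k₂ r₂} s Vk {y} (inl p) Vy with V k₂ in Vk₂ | sub-top s top
    ... | true | nodeT _ _ k≤l _ = ℕP.≤-trans (k≤l Vk here Vk₂) (touched-above (sub-left s) Vk₂ p Vy)
    ... | false | _ = touch-order (<-wellFounded _) i<m Vk Vy (gap-left s Vk₂ p)
    touched-above {r = node l₂ k₂ r₂} s Vk {y} (inr p) Vy with V k₂ in Vk₂ | sub-top s top
    ... | true | nodeT _ _ _ k≤r = ℕP.≤-trans (k≤r Vk here Vk₂) (touched-above (sub-right s) Vk₂ p Vy)
    ... | false | _ = touch-order (<-wellFounded _) i<m Vk Vy (gap-right s Vk₂ p)

    heap-build : ∀ τ → Sub τ T′ → (∀ {h} → h ∈ cut V τ → Heap q h) → Heap q τ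
    heap-build leaf s hanging = leafH
    heap-build (node l k r) s hanging with V k in Vk | sub-top s top
    ... | true | nodeT _ _ k≤l k≤r =
      nodeH (heap-build l (sub-left s) (hanging ∘ ∈-++⁺ˡ)) (heap-build r (sub-right s) (hanging ∘ ∈-++⁺ʳ (cut V l)))
            (λ px → edge (inl px) (k≤l Vk px)) (λ px → edge (inr px) (k≤r Vk px))
      where
      edge : ∀ {x} → x ∈ₜ node l k r → (V x ≡ true → q k ℕ.≤ q x) → q k ℕ.≤ q x
      edge {x} px among-touched with V x in Vx
      ... | true = among-touched refl
      ... | false = touched-above s Vk px Vx
    ... | false | _ = hanging (Any.here refl)

-- Backward direction, part 3: the greedy rearrangement of a top part.

runSteps-++ : ∀ {n} (z : Zipper n) ms₁ ms₂ {z₁ vs₁ z₂ vs₂} → runSteps z ms₁ ≡ just (z₁ , vs₁) →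
  runSteps z₁ ms₂ ≡ just (z₂ , vs₂) → runSteps z (ms₁ ++ ms₂) ≡ just (z₂ , vs₁ ++ vs₂)
runSteps-++ z [] ms₂ refl e₂ = e₂
runSteps-++ z (m ∷ ms) ms₂ e₁ e₂ with step m z
runSteps-++ z (m ∷ ms) ms₂ () e₂ | nothing
... | just z′ with runSteps z′ ms in e
runSteps-++ z (m ∷ ms) ms₂ () e₂ | just z′ | nothing
runSteps-++ z (m ∷ ms) ms₂ refl e₂ | just z′ | just (z″ , vs″) rewrite runSteps-++ z′ ms ms₂ e e₂ =
  cong (λ v → just (_ , v)) (sym (++-assoc (cursorKey z′) vs″ _))

runSteps-∷ : ∀ {n} (z z′ : Zipper n) m ms {z₂ vs} → step m z ≡ just z′ → runSteps z′ ms ≡ just (z₂ , vs) →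
  runSteps z (m ∷ ms) ≡ just (z₂ , cursorKey z′ ++ vs)
runSteps-∷ z z′ m ms e₁ e₂ rewrite e₁ | e₂ = refl

nodes : ∀ {n} → Tree n → ℕ
nodes t = length (inorder t)

module Rearrange {n} (V : Fin n → Bool) (q : Fin n → ℕ) where

  record Minimiser (P : Fin n → Set) : Set where
    constructor minimiser
    field
      key   : Fin n
      holds : P key
      inV   : V key ≡ true
      minimal : ∀ {y} → P y → V y ≡ true → q key ℕ.≤ q y

  MinOrNone : (Fin n → Set) → Set
  MinOrNone P = Minimiser P ⊎ (∀ {y} → P y → V y ≡ false)

  min-∪ : ∀ {P₁ P₂} → MinOrNone P₁ → MinOrNone P₂ → MinOrNone (λ y → P₁ y ⊎ P₂ y)
  min-∪ (inj₂ n₁) (inj₂ n₂) = inj₂ λ { (inj₁ p) → n₁ p ; (inj₂ p) → n₂ p }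
  min-∪ (inj₁ (minimiser r p Vr mn)) (inj₂ n₂) =
    inj₁ (minimiser r (inj₁ p) Vr λ { (inj₁ p′) Vy → mn p′ Vy ; (inj₂ p′) Vy → ⊥-elim (bool-clash (n₂ p′) Vy) })
  min-∪ (inj₂ n₁) (inj₁ (minimiser r p Vr mn)) =
    inj₁ (minimiser r (inj₂ p) Vr λ { (inj₂ p′) Vy → mn p′ Vy ; (inj₁ p′) Vy → ⊥-elim (bool-clash (n₁ p′) Vy) })
  min-∪ (inj₁ (minimiser r₁ p₁ V₁ mn₁)) (inj₁ (minimiser r₂ p₂ V₂ mn₂)) with q r₁ ℕP.≤? q r₂
  ... | yes le = inj₁ (minimiser r₁ (inj₁ p₁) V₁ λ { (inj₁ p′) Vy → mn₁ p′ Vy ; (inj₂ p′) Vy → ℕP.≤-trans le (mn₂ p′ Vy) })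
  ... | no gt = inj₁ (minimiser r₂ (inj₂ p₂) V₂ λ { (inj₂ p′) Vy → mn₂ p′ Vy
                                                   ; (inj₁ p′) Vy → ℕP.≤-trans (ℕP.<⇒≤ (ℕP.≰⇒> gt)) (mn₁ p′ Vy) })

  min-map : ∀ {P P′} → (∀ {y} → P y → P′ y) → (∀ {y} → P′ y → P y) → MinOrNone P → MinOrNone P′
  min-map to from (inj₁ (minimiser r p Vr mn)) = inj₁ (minimiser r (to p) Vr (λ p′ → mn (from p′)))
  min-map to from (inj₂ none) = inj₂ (none ∘ from)

  min-single : ∀ k → MinOrNone (_≡ k)
  min-single k with V k in Vk
  ... | true = inj₁ (minimiser k refl Vk (λ { refl _ → ℕP.≤-refl }))
  ... | false = inj₂ (λ { refl → Vk })

  min-tree : ∀ τ → MinOrNone (_∈ₜ τ)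
  min-tree leaf = inj₂ (λ ())
  min-tree (node l k r) = min-map to from (min-∪ (min-tree l) (min-∪ (min-single k) (min-tree r)))
    where
    to : ∀ {y} → (y ∈ₜ l ⊎ (y ≡ k ⊎ y ∈ₜ r)) → y ∈ₜ node l k r
    to (inj₁ p) = inl p
    to (inj₂ (inj₁ refl)) = here
    to (inj₂ (inj₂ p)) = inr p
    from : ∀ {y} → y ∈ₜ node l k r → (y ∈ₜ l ⊎ (y ≡ k ⊎ y ∈ₜ r))
    from here = inj₂ (inj₁ refl)
    from (inl p) = inj₁ p
    from (inr p) = inj₂ (inj₂ p)

  -- Rotating the node r of τ up to the root gives node (raisedL p) r (raisedR p).
  raisedL raisedR : ∀ {τ : Tree n} {r} → r ∈ₜ τ → Tree n
  raisedL {node l r c} here = l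
  raisedL {node l k c} (inl p) = raisedL p
  raisedL {node l k c} (inr p) = node l k (raisedL p)
  raisedR {node l r c} here = c
  raisedR {node l k c} (inl p) = node (raisedR p) k c
  raisedR {node l k c} (inr p) = raisedR p

  raiseMoves : ∀ {τ : Tree n} {r} → r ∈ₜ τ → List Move
  raiseMoves here = []
  raiseMoves (inl p) = toLeft ∷ raiseMoves p ++ rotate ∷ []
  raiseMoves (inr p) = toRight ∷ raiseMoves p ++ rotate ∷ []

  raise-inorder : ∀ {τ : Tree n} {r} (p : r ∈ₜ τ) → inorder (node (raisedL p) r (raisedR p)) ≡ inorder τ
  raise-inorder here = refl
  raise-inorder {node l k c} {r} (inl p) =
    trans (sym (++-assoc (inorder (raisedL p)) (r ∷ inorder (raisedR p)) (k ∷ inorder c)))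
          (cong (_++ (k ∷ inorder c)) (raise-inorder p))
  raise-inorder {node l k c} {r} (inr p) =
    trans (++-assoc (inorder l) (k ∷ inorder (raisedL p)) (r ∷ inorder (raisedR p)))
          (cong (λ z → inorder l ++ (k ∷ z)) (raise-inorder p))

  raise-cut : ∀ {τ : Tree n} {r} (p : r ∈ₜ τ) → (∀ {a} → Anc τ a r → V a ≡ true) →
    cut V (node (raisedL p) r (raisedR p)) ≡ cut V τ
  raise-cut here above = refl
  raise-cut {node l k c} {r} (inl p) above = begin
    cut V (node A r (node B k c))       ≡⟨ cut-inside V (above (anc-self (inl p))) ⟩
    cut V A ++ cut V (node B k c)       ≡⟨ cong (cut V A ++_) (cut-inside V Vk) ⟩
    cut V A ++ (cut V B ++ cut V c)     ≡⟨ ++-assoc (cut V A) (cut V B) (cut V c) ⟨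
    (cut V A ++ cut V B) ++ cut V c     ≡⟨ cong (_++ cut V c) (cut-inside V (above (anc-self (inl p)))) ⟨
    cut V (node A r B) ++ cut V c       ≡⟨ cong (_++ cut V c) (raise-cut p (above ∘ viaL)) ⟩
    cut V l ++ cut V c                  ≡⟨ cut-inside V Vk ⟨
    cut V (node l k c)                  ∎
    where
    open ≡-Reasoning
    A = raisedL p
    B = raisedR p
    Vk = above (root (inl p))
  raise-cut {node l k c} {r} (inr p) above = begin
    cut V (node (node l k A) r B)       ≡⟨ cut-inside V (above (anc-self (inr p))) ⟩
    cut V (node l k A) ++ cut V B       ≡⟨ cong (_++ cut V B) (cut-inside V Vk) ⟩
    (cut V l ++ cut V A) ++ cut V B     ≡⟨ ++-assoc (cut V l) (cut V A) (cut V B) ⟩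
    cut V l ++ (cut V A ++ cut V B)     ≡⟨ cong (cut V l ++_) (cut-inside V (above (anc-self (inr p)))) ⟨
    cut V l ++ cut V (node A r B)       ≡⟨ cong (cut V l ++_) (raise-cut p (above ∘ viaR)) ⟩
    cut V l ++ cut V c                  ≡⟨ cut-inside V Vk ⟨
    cut V (node l k c)                  ∎
    where
    open ≡-Reasoning
    A = raisedL p
    B = raisedR p
    Vk = above (root (inr p))

  raise-run : ∀ {τ : Tree n} {r} (p : r ∈ₜ τ) → (∀ {a} → Anc τ a r → V a ≡ true) → ∀ fs →
    ∃ λ vis → runSteps (zip τ fs) (raiseMoves p) ≡ just (zip (node (raisedL p) r (raisedR p)) fs , vis) ×
              All (λ y → V y ≡ true) vis × r ∈ (cursorKey (zip τ fs) ++ vis)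
  raise-run here above fs = [] , refl , [] , Any.here refl
  raise-run {node (node l₁ k₁ c₁) k c} {r} (inl p) above fs with raise-run p (above ∘ viaL) (wentL k c ∷ fs)
  ... | vis , e , Vvis , _ =
    k₁ ∷ (vis ++ r ∷ []) ,
    runSteps-∷ (zip (node (node l₁ k₁ c₁) k c) fs) (zip (node l₁ k₁ c₁) (wentL k c ∷ fs)) toLeft (raiseMoves p ++ rotate ∷ []) refl
      (runSteps-++ (zip (node l₁ k₁ c₁) (wentL k c ∷ fs)) (raiseMoves p) (rotate ∷ []) e refl) ,
    (above (viaL (root p)) ∷ AllP.++⁺ Vvis (above (anc-self (inl p)) ∷ [])) ,
    Any.there (Any.there (∈-++⁺ʳ vis (Any.here refl)))
  raise-run {node l k (node l₁ k₁ c₁)} {r} (inr p) above fs with raise-run p (above ∘ viaR) (wentR l k ∷ fs)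
  ... | vis , e , Vvis , _ =
    k₁ ∷ (vis ++ r ∷ []) ,
    runSteps-∷ (zip (node l k (node l₁ k₁ c₁)) fs) (zip (node l₁ k₁ c₁) (wentR l k ∷ fs)) toRight (raiseMoves p ++ rotate ∷ []) refl
      (runSteps-++ (zip (node l₁ k₁ c₁) (wentR l k ∷ fs)) (raiseMoves p) (rotate ∷ []) e refl) ,
    (above (viaR (root p)) ∷ AllP.++⁺ Vvis (above (anc-self (inr p)) ∷ [])) ,
    Any.there (Any.there (∈-++⁺ʳ vis (Any.here refl)))

  AllV : List (Fin n) → Set
  AllV = All (λ y → V y ≡ true)

  -- τ with its top part V rearranged into a heap for q: the moves start and
  -- end at the root, visit only V-keys and visit all of them.
  record Rearranged (τ : Tree n) : Set where
    field
      result   : Tree n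
      moves    : List Move
      inorderE : inorder result ≡ inorder τ
      cutE     : cut V result ≡ cut V τ
      topHeap  : TopHeap V q result
      run      : ∀ fs → ∃ λ vis → runSteps (zip τ fs) moves ≡ just (zip result fs , vis) × AllV vis ×
                   (∀ {x} → x ∈ₜ τ → V x ≡ true → x ∈ (cursorKey (zip τ fs) ++ vis))

  -- The same for a child of a V-node, with moves starting and ending at the parent.
  record ChildRearranged (t : Tree n) : Set where
    field
      result   : Tree n
      movesL movesR : List Move
      inorderE : inorder result ≡ inorder t
      cutE     : cut V result ≡ cut V t
      topHeap  : TopHeap V q result
      runL     : ∀ r B fs → V r ≡ true → ∃ λ vis →
                   runSteps (zip (node t r B) fs) movesL ≡ just (zip (node result r B) fs , vis) × AllV vis ×
                   (∀ {x} → x ∈ₜ t → V x ≡ true → x ∈ vis)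
      runR     : ∀ A r fs → V r ≡ true → ∃ λ vis →
                   runSteps (zip (node A r t) fs) movesR ≡ just (zip (node A r result) fs , vis) × AllV vis ×
                   (∀ {x} → x ∈ₜ t → V x ≡ true → x ∈ vis)

  unchanged : ∀ τ → Untouched V τ → Rearranged τ
  unchanged τ u = record
    { result = τ ; moves = [] ; inorderE = refl ; cutE = refl ; topHeap = untouched-top V q τ u
    ; run = λ fs → [] , refl , [] , λ px Vx → ⊥-elim (bool-clash (u px) Vx) }

  unchanged-child : ∀ t → Untouched V t → ChildRearranged t
  unchanged-child t u = record
    { result = t ; movesL = [] ; movesR = [] ; inorderE = refl ; cutE = refl ; topHeap = untouched-top V q t u
    ; runL = λ r B fs _ → [] , refl , [] , λ px Vx → ⊥-elim (bool-clash (u px) Vx)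
    ; runR = λ A r fs _ → [] , refl , [] , λ px Vx → ⊥-elim (bool-clash (u px) Vx) }

  as-child : ∀ {a k b} → V k ≡ true → Rearranged (node a k b) → ChildRearranged (node a k b)
  as-child {a} {k} {b} Vk R = record
    { result = result ; movesL = toLeft ∷ moves ++ toParent ∷ [] ; movesR = toRight ∷ moves ++ toParent ∷ []
    ; inorderE = inorderE ; cutE = cutE ; topHeap = topHeap ; runL = runL ; runR = runR }
    where
    open Rearranged R
    t = node a k b
    runL : ∀ r B fs → V r ≡ true → ∃ λ vis →
      runSteps (zip (node t r B) fs) (toLeft ∷ moves ++ toParent ∷ []) ≡ just (zip (node result r B) fs , vis) ×
      AllV vis × (∀ {x} → x ∈ₜ t → V x ≡ true → x ∈ vis)
    runL r B fs Vr with run (wentL r B ∷ fs)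
    ... | vis , e , Vvis , covers = k ∷ (vis ++ r ∷ []) ,
      runSteps-∷ (zip (node t r B) fs) (zip t (wentL r B ∷ fs)) toLeft (moves ++ toParent ∷ []) refl
        (runSteps-++ (zip t (wentL r B ∷ fs)) moves (toParent ∷ []) e refl) ,
      (Vk ∷ AllP.++⁺ Vvis (Vr ∷ [])) , λ px Vx → ∈-++⁺ˡ (covers px Vx)
    runR : ∀ A r fs → V r ≡ true → ∃ λ vis →
      runSteps (zip (node A r t) fs) (toRight ∷ moves ++ toParent ∷ []) ≡ just (zip (node A r result) fs , vis) ×
      AllV vis × (∀ {x} → x ∈ₜ t → V x ≡ true → x ∈ vis)
    runR A r fs Vr with run (wentR A r ∷ fs)
    ... | vis , e , Vvis , covers = k ∷ (vis ++ r ∷ []) ,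
      runSteps-∷ (zip (node A r t) fs) (zip t (wentR A r ∷ fs)) toRight (moves ++ toParent ∷ []) refl
        (runSteps-++ (zip t (wentR A r ∷ fs)) moves (toParent ∷ []) e refl) ,
      (Vk ∷ AllP.++⁺ Vvis (Vr ∷ [])) , λ px Vx → ∈-++⁺ˡ (covers px Vx)

  -- Raise a V-key r of least q to the root, then rearrange both subtrees.
  assemble : ∀ {τ r} (p : r ∈ₜ τ) → V r ≡ true → (∀ {a} → Anc τ a r → V a ≡ true) →
    (∀ {y} → y ∈ₜ τ → V y ≡ true → q r ℕ.≤ q y) →
    ChildRearranged (raisedL p) → ChildRearranged (raisedR p) → Rearranged τ
  assemble {τ} {r} p Vr above r-least cA cB = record
    { result = node CA.result r CB.result
    ; moves = raiseMoves p ++ (CA.movesL ++ CB.movesR)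
    ; inorderE = trans (cong₂ (λ a b → a ++ (r ∷ b)) CA.inorderE CB.inorderE) (raise-inorder p)
    ; cutE = begin
        cut V (node CA.result r CB.result)  ≡⟨ cut-inside V Vr ⟩
        cut V CA.result ++ cut V CB.result  ≡⟨ cong₂ _++_ CA.cutE CB.cutE ⟩
        cut V A ++ cut V B                  ≡⟨ cut-inside V Vr ⟨
        cut V (node A r B)                  ≡⟨ raise-cut p above ⟩
        cut V τ                             ∎
    ; topHeap = nodeT CA.topHeap CB.topHeap
        (λ _ px Vx → r-least (in-τ (inl (∈ₜ-inorder CA.inorderE px))) Vx)
        (λ _ px Vx → r-least (in-τ (inr (∈ₜ-inorder CB.inorderE px))) Vx)
    ; run = run }
    where
    open ≡-Reasoning
    A = raisedL p
    B = raisedR p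
    module CA = ChildRearranged cA
    module CB = ChildRearranged cB
    in-τ : ∀ {x} → x ∈ₜ node A r B → x ∈ₜ τ
    in-τ = ∈ₜ-inorder (raise-inorder p)
    run : ∀ fs → ∃ λ vis →
      runSteps (zip τ fs) (raiseMoves p ++ (CA.movesL ++ CB.movesR)) ≡ just (zip (node CA.result r CB.result) fs , vis) ×
      AllV vis × (∀ {x} → x ∈ₜ τ → V x ≡ true → x ∈ (cursorKey (zip τ fs) ++ vis))
    run fs with raise-run p above fs | CA.runL r B fs Vr | CB.runR CA.result r fs Vr
    ... | vis₁ , e₁ , V₁ , r∈ | visA , eA , VA , coverA | visB , eB , VB , coverB =
      vis₁ ++ (visA ++ visB) ,
      runSteps-++ (zip τ fs) (raiseMoves p) _ e₁ (runSteps-++ (zip (node A r B) fs) CA.movesL CB.movesR eA eB) ,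
      AllP.++⁺ V₁ (AllP.++⁺ VA VB) , cover
      where
      ck = cursorKey (zip τ fs)
      cover : ∀ {x} → x ∈ₜ τ → V x ≡ true → x ∈ (ck ++ (vis₁ ++ (visA ++ visB)))
      cover px Vx with ∈ₜ-inorder (sym (raise-inorder p)) px
      ... | here = subst (r ∈_) (++-assoc ck vis₁ (visA ++ visB)) (∈-++⁺ˡ r∈)
      ... | inl pa = ∈-++⁺ʳ ck (∈-++⁺ʳ vis₁ (∈-++⁺ˡ (coverA pa Vx)))
      ... | inr pb = ∈-++⁺ʳ ck (∈-++⁺ʳ vis₁ (∈-++⁺ʳ visA (coverB pb Vx)))

  raised-smaller : ∀ {τ r} (p : r ∈ₜ τ) {fuel} → nodes τ ℕ.≤ suc fuel →
    nodes (raisedL p) ℕ.≤ fuel × nodes (raisedR p) ℕ.≤ fuel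
  raised-smaller {τ} {r} p {fuel} sz =
    ℕP.≤-pred (ℕP.≤-trans (s≤s (ℕP.m≤m+n a b)) total) , ℕP.≤-pred (ℕP.≤-trans (s≤s (ℕP.m≤n+m b a)) total)
    where
    a = nodes (raisedL p)
    b = nodes (raisedR p)
    total : suc (a + b) ℕ.≤ suc fuel
    total = subst (ℕ._≤ suc fuel)
              (trans (trans (cong length (sym (raise-inorder p))) (length-++ (inorder (raisedL p)))) (ℕP.+-suc a b)) sz

  raised-closed : ∀ {τ r} (p : r ∈ₜ τ) → V r ≡ true → (∀ {a} → Anc τ a r → V a ≡ true) → Closed V τ →
    Closed V (raisedL p) × Closed V (raisedR p)
  raised-closed p Vr above cl = AllP.++⁻ˡ (cut V (raisedL p)) both , AllP.++⁻ʳ (cut V (raisedL p)) both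
    where
    both : All (Untouched V) (cut V (raisedL p) ++ cut V (raisedR p))
    both = subst (All (Untouched V)) (trans (sym (raise-cut p above)) (cut-inside V Vr)) cl

  mutual
    rearrange : ∀ fuel τ → nodes τ ℕ.≤ fuel → Closed V τ → Rearranged τ
    rearrange fuel leaf sz cl = unchanged leaf (λ ())
    rearrange zero (node l k r) sz cl =
      ⊥-elim (ℕP.<-irrefl refl (ℕP.<-≤-trans (ℕP.≤-trans (s≤s z≤n) (ℕP.m≤n+m (suc (nodes r)) (nodes l)))
                                              (subst (ℕ._≤ 0) (length-++ (inorder l)) sz)))
    rearrange (suc fuel) τ@(node _ _ _) sz cl with min-tree τ
    ... | inj₂ none = unchanged τ none
    ... | inj₁ (minimiser r p Vr r-least) =
      assemble p Vr above r-least (rearrange-child fuel _ (proj₁ smaller) (proj₁ closed))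
                                  (rearrange-child fuel _ (proj₂ smaller) (proj₂ closed))
      where
      above : ∀ {a} → Anc τ a r → V a ≡ true
      above an = closed-anc V cl an Vr
      smaller = raised-smaller p sz
      closed = raised-closed p Vr above cl

    rearrange-child : ∀ fuel t → nodes t ℕ.≤ fuel → Closed V t → ChildRearranged t
    rearrange-child fuel leaf sz cl = unchanged-child leaf (λ ())
    rearrange-child fuel (node a k b) sz cl with V k in Vk
    ... | false = unchanged-child _ (All.head cl)
    ... | true = as-child Vk (rearrange fuel (node a k b) sz (subst (All (Untouched V)) (sym (cut-inside V Vk)) cl))

-- Backward direction, part 4: serving the accesses greedily.

∈⇒∈ᵇ : ∀ {n} {x : Fin n} {L} → x ∈ L → (x ∈ᵇ L) ≡ true
∈⇒∈ᵇ {x = x} (Any.here refl) rewrite ≟-refl x = refl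
∈⇒∈ᵇ {x = x} {y ∷ L} (Any.there p) rewrite ∈⇒∈ᵇ p = ∨-zeroʳ ⌊ x ≟ y ⌋

∈ᵇ⇒∈ : ∀ {n} {x : Fin n} L → (x ∈ᵇ L) ≡ true → x ∈ L
∈ᵇ⇒∈ {x = x} (y ∷ L) e with x ≟ y
... | yes refl = Any.here refl
... | no _ = Any.there (∈ᵇ⇒∈ L e)

sum-mono : ∀ {k} {g h : Fin k → ℕ} → (∀ t → g t ℕ.≤ h t) → sum g ℕ.≤ sum h
sum-mono {zero} g≤h = z≤n
sum-mono {suc k} g≤h = ℕP.+-mono-≤ (g≤h F.zero) (sum-mono (g≤h ∘ F.suc))

ind-mono : ∀ {a b} → (a ≡ true → b ≡ true) → ind a ℕ.≤ ind b
ind-mono {true} a⇒b rewrite a⇒b refl = ℕP.≤-refl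
ind-mono {false} _ = z≤n

distinctCount-≤ : ∀ {n} (V : Fin n → Bool) L → All (λ y → V y ≡ true) L → distinctCount L ℕ.≤ sum (λ k → ind (V k))
distinctCount-≤ {n} V L VL = subst (ℕ._≤ _) (sym (countTrue-tabulate id L))
  (sum-mono {n} {λ k → ind (k ∈ᵇ L)} λ k → ind-mono λ e → All.lookup VL (∈ᵇ⇒∈ L e))

-- The initial tree: a right path, later rearranged into a heap.
rightPath : ∀ {n} → List (Fin n) → Tree n
rightPath [] = leaf
rightPath (k ∷ ks) = node leaf k (rightPath ks)

inorder-rightPath : ∀ {n} (ks : List (Fin n)) → inorder (rightPath ks) ≡ ks
inorder-rightPath [] = refl
inorder-rightPath (k ∷ ks) = cong (k ∷_) (inorder-rightPath ks)

root-in-top : ∀ {n} (V : Fin n → Bool) (T : Tree n) {x} → Closed V T → x ∈ₜ T → V x ≡ true →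
  All (λ y → V y ≡ true) (cursorKey (atRoot T))
root-in-top V (node l k r) cl px Vx = closed-anc V cl (root px) Vx ∷ []

module Serve {m n} (Q : PointSet m n) (sat : Satisfied Q) where
  open NextTouch Q
  open Touching Q sat

  touched : ℕ → ℕ
  touched t = sum (λ k → ind (S t k))

  record Operation (i : ℕ) (x : Fin n) (T : Tree n) : Set where
    field
      moves  : List Move
      after  : Tree n
      visits : List (Fin n)
      ran    : runSteps (atRoot T) moves ≡ just (zip after [] , visits)
      found  : (x ∈ᵇ (cursorKey (atRoot T) ++ visits)) ≡ true
      cheap  : distinctCount (cursorKey (atRoot T) ++ visits) ℕ.≤ touched i
      bst    : IsBSTOn after
      heap   : Heap (next (suc i)) after

  operation : ∀ {i x} → i ℕ.< m → (T : Tree n) → IsBSTOn T → Heap (next i) T → S i x ≡ true → Operation i x T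
  operation {i} {x} i<m T bs heapT Sx = record
    { moves = moves ; after = result ; visits = proj₁ ran ; ran = proj₁ (proj₂ ran)
    ; found = ∈⇒∈ᵇ (proj₂ (proj₂ (proj₂ ran)) x∈T Sx)
    ; cheap = distinctCount-≤ V _ (AllP.++⁺ (root-in-top V T closedT x∈T Sx) (proj₁ (proj₂ (proj₂ ran))))
    ; bst = bs′ ; heap = heap′ }
    where
    V = S i
    closedT : Closed V T
    closedT = heap-closed T i<m heapT
    open Rearrange.Rearranged (Rearrange.rearrange V (next (suc i)) (nodes T) T ℕP.≤-refl closedT)
    ran = run []
    x∈T : x ∈ₜ T
    x∈T = bstOn-∈ T bs x
    bs′ : IsBSTOn result
    bs′ = trans inorderE bs
    -- hanging subtrees are untouched parts of T, where next i = next (i + 1)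
    hanging-heap : ∀ {τ} → τ ∈ cut V result → Heap (next (suc i)) τ
    hanging-heap {τ} τ∈ = heap-cong (λ py → next-later i<m (All.lookup closedT τ∈T py)) (sub-heap (cut-sub V T τ∈T) heapT)
      where τ∈T = subst (τ ∈_) cutE τ∈
    heap′ : Heap (next (suc i)) result
    heap′ = Rebuilt.heap-build i<m result (bstOn⇒SearchTree result bs′) (bstOn-∈ result bs′)
              (subst (All (Untouched V)) (sym cutE) closedT) topHeap result self hanging-heap

  record Schedule (xs : List (Fin n)) (i : ℕ) (T : Tree n) : Set where
    field
      plan    : List (List Move)
      cost    : ℕ
      served  : serveCost T xs plan ≡ just cost
      bounded : cost ℕ.≤ sum {length xs} (λ t → touched (i + toℕ t))

  serve : ∀ xs i (T : Tree n) → (∀ {t y} → At xs t y → S (i + t) y ≡ true) → i + length xs ≡ m →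
    IsBSTOn T → Heap (next i) T → Schedule xs i T
  serve [] i T _ _ _ _ = record { plan = [] ; cost = 0 ; served = refl ; bounded = z≤n }
  serve (x ∷ xs) i T accessed i+L≡m bs heapT = record
    { plan = moves ∷ plan ; cost = distinctCount (cursorKey (atRoot T) ++ visits) + cost
    ; served = served′ ; bounded = bounded′ }
    where
    i<m : i ℕ.< m
    i<m = subst (i ℕ.<_) i+L≡m (ℕP.m<m+n i (s≤s z≤n))
    open Operation (operation i<m T bs heapT (subst (λ u → S u x ≡ true) (ℕP.+-identityʳ i) (accessed atZ)))
    open Schedule (serve xs (suc i) after
      (λ {t} {y} p → subst (λ u → S u y ≡ true) (ℕP.+-suc i t) (accessed (atS p)))
      (trans (sym (ℕP.+-suc i (length xs))) i+L≡m) bst heap)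
    served′ : serveCost T (x ∷ xs) (moves ∷ plan) ≡ just (distinctCount (cursorKey (atRoot T) ++ visits) + cost)
    served′ rewrite ran | found | served = refl
    bounded′ : distinctCount (cursorKey (atRoot T) ++ visits) + cost ℕ.≤ sum {suc (length xs)} (λ t → touched (i + toℕ t))
    bounded′ = ℕP.+-mono-≤ (subst (λ u → distinctCount (cursorKey (atRoot T) ++ visits) ℕ.≤ touched u)
                                  (sym (ℕP.+-identityʳ i)) cheap)
                           (subst (cost ℕ.≤_) (sum-cong-≗ {length xs} (λ t → cong touched (sym (ℕP.+-suc i (toℕ t))))) bounded)

backward : ∀ {m n} (f : Fin m → Fin n) c → SatisfiedSuperset f c → ∃ λ c′ → c′ ℕ.≤ c × Achievable (tabulate f) c′
backward {m} {n} f c (Q , sat , access , sz) = cost , subst (cost ℕ.≤_) total bounded , T₀ , plan , bs₀ , served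
  where
  open NextTouch Q
  open Serve Q sat
  start = rightPath (allFin n)
  open Rearrange.Rearranged (Rearrange.rearrange (λ _ → true) (next 0) (nodes start) start ℕP.≤-refl (closed-all start))
    using (inorderE; topHeap) renaming (result to T₀)
  bs₀ : IsBSTOn T₀
  bs₀ = trans inorderE (inorder-rightPath (allFin n))
  accessed : ∀ {t y} → At (tabulate f) t y → S (0 + t) y ≡ true
  accessed p with at-tabulate⁻ f p
  ... | i , refl , refl = trans (row-toℕ Q i (f i)) (access i)
  open Schedule (serve (tabulate f) 0 T₀ accessed (length-tabulate f) bs₀ (topHeap-all (next 0) topHeap))
  total : sum {length (tabulate f)} (λ t → touched (toℕ t)) ≡ c
  total = begin
    sum {length (tabulate f)} (touched ∘ toℕ) ≡⟨ cong (λ L → sum {L} (touched ∘ toℕ)) (length-tabulate f) ⟩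
    sum {m} (touched ∘ toℕ)                   ≡⟨ sum-cong-≗ (λ t → sum-cong-≗ (λ k → cong ind (row-toℕ Q t k))) ⟩
    size Q                                    ≡⟨ sz ⟩
    c                                         ∎
    where open ≡-Reasoning

-- OPT and its invariance under inverse and reversal.

opt-geometric : ∀ {m n} (f : Fin m → Fin n) c → Least (SatisfiedSuperset f) c → IsOPT (tabulate f) c
opt-geometric f c (sat-c , minimal) with backward f c sat-c
... | c′ , c′≤c , achieved =
  subst (Achievable (tabulate f)) (ℕP.≤-antisym c′≤c (minimal c′ (forward f c′ achieved))) achieved ,
  λ c″ a → minimal c″ (forward f c″ a)

least-transfer : ∀ {m n} {f g : Fin m → Fin n} {c} →
  (∀ c′ → SatisfiedSuperset f c′ → SatisfiedSuperset g c′) → (∀ c′ → SatisfiedSuperset g c′ → SatisfiedSuperset f c′) →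
  Least (SatisfiedSuperset f) c → Least (SatisfiedSuperset g) c
least-transfer f⇒g g⇒f (sat-c , minimal) = f⇒g _ sat-c , λ c′ s → minimal c′ (g⇒f c′ s)

tabulate-∷ʳ : ∀ {A : Set} {n} (h : Fin (suc n) → A) → tabulate h ≡ tabulate (h ∘ inject₁) ∷ʳ h (fromℕ n)
tabulate-∷ʳ {n = zero} h = refl
tabulate-∷ʳ {n = suc n} h = cong (h F.zero ∷_) (tabulate-∷ʳ (h ∘ F.suc))

reverse-tabulate : ∀ {A : Set} {n} (f : Fin n → A) → reverse (tabulate f) ≡ tabulate (f ∘ opposite)
reverse-tabulate {n = zero} f = refl
reverse-tabulate {n = suc n} f = begin
  reverse (tabulate f)                                       ≡⟨ unfold-reverse (f F.zero) (tabulate (f ∘ F.suc)) ⟩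
  reverse (tabulate (f ∘ F.suc)) ∷ʳ f F.zero                 ≡⟨ cong (_∷ʳ f F.zero) (reverse-tabulate (f ∘ F.suc)) ⟩
  tabulate (f ∘ F.suc ∘ opposite) ∷ʳ f F.zero                ≡⟨ cong₂ _∷ʳ_ (tabulate-cong (λ i → cong f (opposite-inject₁ i)))
                                                                              (cong f (opposite-fromℕ n)) ⟨
  tabulate (f ∘ opposite ∘ inject₁) ∷ʳ f (opposite (fromℕ n)) ≡⟨ tabulate-∷ʳ (f ∘ opposite) ⟨
  tabulate (f ∘ opposite)                                    ∎
  where
  open ≡-Reasoning
  opposite-inject₁ : ∀ {n} (i : Fin n) → opposite {suc n} (inject₁ i) ≡ F.suc (opposite i)
  opposite-inject₁ {n} i = FP.toℕ-injective (begin
    toℕ (opposite (inject₁ i))  ≡⟨ FP.opposite-prop (inject₁ i) ⟩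
    n ∸ toℕ (inject₁ i)         ≡⟨ cong (n ∸_) (FP.toℕ-inject₁ i) ⟩
    n ∸ toℕ i                   ≡⟨ ℕP.+-∸-assoc 1 (FP.toℕ<n i) ⟩
    suc (n ∸ suc (toℕ i))       ≡⟨ cong suc (FP.opposite-prop i) ⟨
    toℕ (F.suc (opposite i))    ∎)
  opposite-fromℕ : ∀ n → opposite {suc n} (fromℕ n) ≡ F.zero
  opposite-fromℕ n = FP.toℕ-injective (trans (FP.opposite-prop (fromℕ n)) (trans (cong (n ∸_) (FP.toℕ-fromℕ n)) (ℕP.n∸n≡0 n)))

seqOf-tabulate : ∀ {n} (X : Permutation′ n) → seqOf X ≡ tabulate (X ⟨$⟩ʳ_)
seqOf-tabulate X = map-tabulate id (X ⟨$⟩ʳ_)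

mainTheorem8 : (n : ℕ) (X : Permutation′ n) →
    Σ ℕ λ c → IsOPT (seqOf X) c × IsOPT (seqOf (flip X)) c × IsOPT (reverse (seqOf X)) c
mainTheorem8 n X with least (SatisfiedSuperset f) (satisfiedSuperset? f) _ (full f)
  where f = X ⟨$⟩ʳ_
... | c , least-c = c , opt-X , opt-X⁻¹ , opt-Xʳ
  where
  f = X ⟨$⟩ʳ_
  g = X ⟨$⟩ˡ_
  least-g : Least (SatisfiedSuperset g) c
  least-g = least-transfer (λ c′ → transpose f g c′ (λ _ → inverseʳ X))
                           (λ c′ → transpose g f c′ (λ _ → inverseˡ X)) least-c
  least-fʳ : Least (SatisfiedSuperset (f ∘ opposite)) c
  least-fʳ = least-transfer (λ c′ → reflect f (f ∘ opposite) c′ (λ _ → refl))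
                            (λ c′ → reflect (f ∘ opposite) f c′ (cong f ∘ sym ∘ FP.opposite-involutive)) least-c
  opt-X : IsOPT (seqOf X) c
  opt-X = subst (λ xs → IsOPT xs c) (sym (seqOf-tabulate X)) (opt-geometric f c least-c)
  opt-X⁻¹ : IsOPT (seqOf (flip X)) c
  opt-X⁻¹ = subst (λ xs → IsOPT xs c) (sym (seqOf-tabulate (flip X))) (opt-geometric g c least-g)
  opt-Xʳ : IsOPT (reverse (seqOf X)) c
  opt-Xʳ = subst (λ xs → IsOPT xs c) (sym (trans (cong reverse (seqOf-tabulate X)) (reverse-tabulate f)))
                 (opt-geometric (f ∘ opposite) c least-fʳ)
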